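{- Let $\Sigma$ be a finite alphabet, $w$ a positive integer, $\tau=(R_1,\dots,R_m)$ a relational vocabulary, and $\varphi(x_1,\dots,x_n)$ a first-order formula over $\tau$ whose free variables are among $x_1,\dots,x_n$. Then the relation $$\mathcal{R}(\Sigma,w,\tau,\varphi(x_1,\dots,x_n))=\{(D_0,D_1,\dots,D_m,v_1,\dots,v_n):(D_0,\dots,D_m)\in\mathcal{R}(\Sigma,w,\tau),\ v_1,\dots,v_n\in L(D_0),\ \mathcal{S}(D_0,\dots,D_m)\models\varphi[v_1,\dots,v_n]\}$$ is regular.
   Context: Padding and tensor products. Fix a padding symbol $\#$ not in any alphabet considered. For alphabets $\Gamma_1,\dots,\Gamma_a$, $\Gamma_1\otimes\cdots\otimes\Gamma_a$ is the Cartesian product regarded as an alphabet, and $\Gamma^{\otimes a}$ its $a$-fold power. For nonempty strings $u_i$ over $\Gamma_i$ of lengths $n_i$, $u_1\otimes\cdots\otimes u_a$ is the string of length $\max_i n_i$ whose $j$-th symbol is the tuple of $j$-th symbols of the $u_i$, with $\#$ in place of missing symbols. For languages, $L_1\otimes\cdots\otimes L_a=\{u_1\otimes\cdots\otimes u_a:u_i\in L_i\}$ and $L^{\otimes a}$ is the $a$-fold product. For a language $L$ over a tensor alphabet, $\mathcal{R}(L)=\{(u_1,\dots,u_a):u_1\otimes\cdots\otimes u_a\in L\}$. A relation $R\subseteq\Gamma_1^+\times\cdots\times\Gamma_a^+$ is regular if $\{u_1\otimes\cdots\otimes u_a:(u_1,\dots,u_a)\in R\}$ is accepted by a finite automaton.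 ODDs. For an alphabet $\Sigma$ and $w\ge1$, a $(\Sigma,w)$-layer is a tuple $B=(\ell,r,T,I,F,\iota,\phi)$ with $\ell,r\subseteq\{0,\dots,w-1\}$, $T\subseteq\ell\times(\Sigma\sqcup\{\#\})\times r$, $I\subseteq\ell$, $F\subseteq r$, $\iota,\phi$ Booleans, $I=\emptyset$ if $\iota$ is false and $F=\emptyset$ if $\phi$ is false. $\mathcal{B}(\Sigma,w)$ is the finite set of such layers, an alphabet. A $(\Sigma,w)$-ODD of length $k$ is a string $B_1\cdots B_k$ over $\mathcal{B}(\Sigma,w)$ with $\ell(B_{i+1})=r(B_i)$, $\iota(B_i)$ true iff $i=1$, $\phi(B_i)$ true iff $i=k$; $\mathcal{B}(\Sigma,w,k)$ is the set of them. A nonempty string $\sigma_1\cdots\sigma_{k'}$ over $\Sigma$, $k'\le k$, is accepted if, padding it with $\#$ to length $k$ (symbols $\hat\sigma_i$), there are $(p_i,\hat\sigma_i,q_i)\in T(B_i)$ with $p_{i+1}=q_i$, $p_1\in I(B_1)$, $q_k\in F(B_k)$; $L(D)$ is the set of accepted strings. Structural tuples. $\tau=(R_1,\dots,R_m)$ has arities $a_i$. A tuple $(D_0,\dots,D_m)$ is $(\Sigma,w,\tau)$-structural if for some $k\ge1$, $D_0\in\mathcal{B}(\Sigma,w,k)$, $D_i\in\mathcal{B}(\Sigma^{\otimes a_i},w,k)$ and $L(D_i)\subseteq L(D_0)^{\otimes a_i}$ for $i\in[m]$; its derived structure $\mathcal{S}(D_0,\dots,D_m)$ is the $\tau$-structure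 with domain $L(D_0)$ interpreting $R_i$ as $\mathcal{R}(L(D_i))$. $\mathcal{R}(\Sigma,w,\tau)$ is the set of all structural tuples. The relation in the claim has coordinates in $\mathcal{B}(\Sigma,w)^+$, $\mathcal{B}(\Sigma^{\otimes a_i},w)^+$ and $\Sigma^+$ respectively. -}

module Defs where

open import Data.Nat using (ℕ; zero; suc; _≤_; _<_; _∸_; _⊔_; _≡ᵇ_)
open import Data.Fin using (Fin; zero; suc; toℕ)
open import Data.List using (List; []; _∷_; length; map; replicate; _++_)
import Data.List as L
open import Data.Vec using (Vec; []; _∷_)
open import Data.Maybe using (Maybe; just; nothing)
open import Data.Bool using (Bool; true; false)
open import Data.Product using (Σ; _×_; _,_; proj₁; proj₂)
open import Data.Unit using (⊤; tt)
open import Data.Empty using (⊥)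
open import Relation.Binary.PropositionalEquality using (_≡_)
open import Function.Bundles using (_⇔_)

StrTup : List Set → Set
StrTup []       = ⊤
StrTup (A ∷ As) = List A × StrTup As

-- a symbol of Γ₁ ⊗ ⋯ ⊗ Γ_a (each component possibly the padding #)
SymTup : List Set → Set
SymTup []       = ⊤
SymTup (A ∷ As) = Maybe A × SymTup As

AllNE : (As : List Set) → StrTup As → Set
AllNE []       tt       = ⊤
AllNE (A ∷ As) (u , us) = (0 < length u) × AllNE As us

maxLen : (As : List Set) → StrTup As → ℕ
maxLen []       tt       = 0
maxLen (A ∷ As) (u , us) = length u ⊔ maxLen As us

hds : (As : List Set) → StrTup As → SymTup As
hds []       tt            = tt
hds (A ∷ As) ([] , us)     = nothing , hds As us
hds (A ∷ As) (x ∷ u , us)  = just x , hds As us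

tls : (As : List Set) → StrTup As → StrTup As
tls []       tt            = tt
tls (A ∷ As) ([] , us)     = [] , tls As us
tls (A ∷ As) (x ∷ u , us)  = u , tls As us

tensorN : (As : List Set) → ℕ → StrTup As → List (SymTup As)
tensorN As zero    us = []
tensorN As (suc k) us = hds As us ∷ tensorN As k (tls As us)

tensor : (As : List Set) → StrTup As → List (SymTup As)
tensor As us = tensorN As (maxLen As us) us

splitTup : (As Bs : List Set) → StrTup (As ++ Bs) → StrTup As × StrTup Bs
splitTup []       Bs us       = tt , us
splitTup (A ∷ As) Bs (u , us) = (u , proj₁ (splitTup As Bs us)) , proj₂ (splitTup As Bs us)

record DFA (A : Set) : Set where
  field
    nQ    : ℕ
    start : Fin nQ
    δ     : Fin nQ → A → Fin nQ
    acc   : Fin nQ → Bool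

runDFA : {A : Set} (M : DFA A) → Fin (DFA.nQ M) → List A → Fin (DFA.nQ M)
runDFA M q []       = q
runDFA M q (x ∷ xs) = runDFA M (DFA.δ M q x) xs

AcceptsDFA : {A : Set} → DFA A → List A → Set
AcceptsDFA M xs = DFA.acc M (runDFA M (DFA.start M) xs) ≡ true

RegularRel : (As : List Set) → (StrTup As → Set) → Set
RegularRel As R =
  Σ (DFA (SymTup As)) λ M →
    (x : List (SymTup As)) →
      AcceptsDFA M x ⇔ Σ (StrTup As) (λ us → AllNE As us × R us × tensor As us ≡ x)

Tens : Set → ℕ → Set
Tens A a = SymTup (replicate a A)

AllRep : {A : Set} (a : ℕ) → (List A → Set) → StrTup (replicate a A) → Set
AllRep zero    P tt       = ⊤
AllRep (suc a) P (u , us) = P u × AllRep a P us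

InPow : {A : Set} → (List A → Set) → (a : ℕ) → List (Tens A a) → Set
InPow {A} P a x =
  Σ (StrTup (replicate a A)) λ us → AllNE (replicate a A) us × AllRep a P us × tensor (replicate a A) us ≡ x

vecToTup : {A : Set} {a : ℕ} → Vec (List A) a → StrTup (replicate a A)
vecToTup []       = tt
vecToTup (u ∷ us) = u , vecToTup us

tupToVec : {A : Set} (a : ℕ) → StrTup (replicate a A) → Vec (List A) a
tupToVec zero    tt       = []
tupToVec (suc a) (u , us) = u ∷ tupToVec a us

-- Layers and ODDs.  Subsets of {0,…,w-1} are Bool-valued predicates on Fin w;
-- # is nothing.

record Layer (A : Set) (w : ℕ) : Set where
  field
    ℓ  : Fin w → Bool
    r  : Fin w → Bool
    T  : Fin w → Maybe A → Fin w → Bool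
    I  : Fin w → Bool
    F  : Fin w → Bool
    ι  : Bool
    φ  : Bool
    T⊆ : ∀ p σ q → T p σ q ≡ true → (ℓ p ≡ true) × (r q ≡ true)
    I⊆ : ∀ p → I p ≡ true → ℓ p ≡ true
    F⊆ : ∀ q → F q ≡ true → r q ≡ true
    ιI : ι ≡ false → ∀ p → I p ≡ false
    φF : φ ≡ false → ∀ q → F q ≡ false

open Layer public

Adjacent : {A : Set} {w : ℕ} → List (Layer A w) → Set
Adjacent []             = ⊤
Adjacent (B ∷ [])       = ⊤
Adjacent (B ∷ B′ ∷ Bs)  = (∀ p → ℓ B′ p ≡ r B p) × Adjacent (B′ ∷ Bs)

IsODD : {A : Set} {w : ℕ} → ℕ → List (Layer A w) → Set
IsODD k D =
  (length D ≡ k) × (1 ≤ k) × Adjacent D ×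
  ((i : Fin (length D)) →
     (ι (L.lookup D i) ≡ (toℕ i ≡ᵇ 0)) × (φ (L.lookup D i) ≡ (suc (toℕ i) ≡ᵇ length D)))

firstI : {A : Set} {w : ℕ} → List (Layer A w) → Fin w → Bool
firstI []      p = false
firstI (B ∷ _) p = I B p

lastF : {A : Set} {w : ℕ} → List (Layer A w) → Fin w → Bool
lastF []            q = false
lastF (B ∷ [])      q = F B q
lastF (B ∷ B′ ∷ Bs) q = lastF (B′ ∷ Bs) q

Path : {A : Set} {w : ℕ} → List (Layer A w) → List (Maybe A) → Fin w → Fin w → Set
Path []       []       p q = p ≡ q
Path (B ∷ Bs) (σ ∷ σs) p q = Σ (Fin _) λ p′ → (T B p σ p′ ≡ true) × Path Bs σs p′ q
Path []       (_ ∷ _)  p q = ⊥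
Path (_ ∷ _)  []       p q = ⊥

pad : {A : Set} → ℕ → List A → List (Maybe A)
pad k u = map just u ++ replicate (k ∸ length u) nothing

AcceptsODD : {A : Set} {w : ℕ} → List (Layer A w) → List A → Set
AcceptsODD {w = w} D u =
  (0 < length u) × (length u ≤ length D) ×
  Σ (Fin w) λ p → Σ (Fin w) λ q →
    (firstI D p ≡ true) × (lastF D q ≡ true) × Path D (pad (length D) u) p q

Vocab : Set
Vocab = List ℕ

-- formulas whose free variables are among n variables (de Bruijn: a binder
-- introduces variable zero)
data Formula (τ : Vocab) : ℕ → Set where
  atom  : ∀ {n} (i : Fin (length τ)) → Vec (Fin n) (L.lookup τ i) → Formula τ n
  equal : ∀ {n} → Fin n → Fin n → Formula τ n
  neg   : ∀ {n} → Formula τ n → Formula τ n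
  conj  : ∀ {n} → Formula τ n → Formula τ n → Formula τ n
  disj  : ∀ {n} → Formula τ n → Formula τ n → Formula τ n
  ex    : ∀ {n} → Formula τ (suc n) → Formula τ n
  all   : ∀ {n} → Formula τ (suc n) → Formula τ n

-- a τ-structure whose domain is a subset of a carrier set U
record Structure (τ : Vocab) (U : Set) : Set₁ where
  field
    Dom : U → Set
    Rel : (i : Fin (length τ)) → Vec U (L.lookup τ i) → Set

Sat : {τ : Vocab} {U : Set} {n : ℕ} → Structure τ U → Formula τ n → Vec U n → Set
Sat S (atom i xs)  ρ = Structure.Rel S i (Data.Vec.map (Data.Vec.lookup ρ) xs)
Sat S (equal x y)  ρ = Data.Vec.lookup ρ x ≡ Data.Vec.lookup ρ y
Sat S (neg ψ)      ρ = Sat S ψ ρ → ⊥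
Sat S (conj ψ χ)   ρ = Sat S ψ ρ × Sat S χ ρ
Sat S (disj ψ χ)   ρ = Data.Sum._⊎_ (Sat S ψ ρ) (Sat S χ ρ)
  where import Data.Sum
Sat S (ex ψ)       ρ = Σ _ λ u → Structure.Dom S u × Sat S ψ (u ∷ ρ)
Sat S (all ψ)      ρ = ∀ u → Structure.Dom S u → Sat S ψ (u ∷ ρ)

LayerT : ℕ → ℕ → ℕ → Set
LayerT s w a = Layer (Tens (Fin s) a) w

LayersT : ℕ → ℕ → Vocab → List Set
LayersT s w τ = map (LayerT s w) τ

getD : (s w : ℕ) (τ : Vocab) → StrTup (LayersT s w τ) →
       (i : Fin (length τ)) → List (LayerT s w (L.lookup τ i))
getD s w (a ∷ τ) (D , Ds) zero    = D
getD s w (a ∷ τ) (D , Ds) (suc i) = getD s w τ Ds i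

AllStructural : (s w : ℕ) (τ : Vocab) (k : ℕ) → List (Layer (Fin s) w) →
                StrTup (LayersT s w τ) → Set
AllStructural s w []      k D₀ tt       = ⊤
AllStructural s w (a ∷ τ) k D₀ (D , Ds) =
  IsODD k D × (∀ x → AcceptsODD D x → InPow (AcceptsODD D₀) a x) ×
  AllStructural s w τ k D₀ Ds

IsStructural : (s w : ℕ) (τ : Vocab) → List (Layer (Fin s) w) → StrTup (LayersT s w τ) → Set
IsStructural s w τ D₀ Ds = Σ ℕ λ k → IsODD k D₀ × AllStructural s w τ k D₀ Ds

derived : (s w : ℕ) (τ : Vocab) → List (Layer (Fin s) w) → StrTup (LayersT s w τ) →
          Structure τ (List (Fin s))
derived s w τ D₀ Ds = record
  { Dom = AcceptsODD D₀
  ; Rel = λ i vs → AcceptsODD (getD s w τ Ds i) (tensor _ (vecToTup vs))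
  }

FOSig : (s w : ℕ) (τ : Vocab) (n : ℕ) → List Set
FOSig s w τ n = Layer (Fin s) w ∷ (LayersT s w τ ++ replicate n (Fin s))

FORel : (s w : ℕ) (τ : Vocab) (n : ℕ) → Formula τ n → StrTup (FOSig s w τ n) → Set
FORel s w τ n φ′ (D₀ , rest) =
  IsStructural s w τ D₀ Ds × AllRep n (AcceptsODD D₀) vs ×
  Sat (derived s w τ D₀ Ds) φ′ (tupToVec n vs)
  where
    Ds = proj₁ (splitTup (LayersT s w τ) (replicate n (Fin s)) rest)
    vs = proj₂ (splitTup (LayersT s w τ) (replicate n (Fin s)) rest)

-- Read a tuple (D₀, D₁, …, D_m, v₁, …, vₙ) column by column as a word of length |D₀|: in a
-- structural tuple D₀ is a longest coordinate. By induction on φ, the encodings of structural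
-- tuples with assignments satisfying φ form a regular language. Being structural is regular: the
-- ODD conditions are checked layer by layer, acceptance of a padded track by an ODD track is
-- decided by tracking sets of reachable states, and L(Dᵢ) ⊆ L(D₀)^{⊗aᵢ} is the complement of a
-- projection of a regular language. An atom Rᵢ(x̄) asks the Dᵢ track to accept the tensor of the
-- selected vertex tracks, and x = y is a letterwise test. Since the encoding is injective on
-- structural tuples, the connectives follow from closure under product and complement, ∃ from
-- projection along a new vertex track, and ∀ from ¬∃¬, satisfaction being decidable because its
-- language is regular. The column word is the tensor of the tuple up to a bijection of letters.

module Submission where

open import Data.Bool using (Bool; true; false; _∧_; _∨_; not; if_then_else_) renaming (T to IsTrue; _≟_ to _≟ᵇ_)
open import Data.Bool.Properties using (T-≡; T-not-≡; T-∧; T-∨)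
open import Data.Fin using (Fin; zero; suc; toℕ) renaming (_≟_ to _≟ᶠ_)
open import Data.Fin.Properties using (1↔⊤; 2↔Bool; *↔×; +↔⊎; any?; all?)
open import Data.List using (List; []; _∷_; length; map; replicate; _++_; zip; foldl; drop)
import Data.List
open import Data.List.Properties
  using (length-map; length-++; length-replicate; map-∘; map-id; map-cong-local; map-injective; zip-map; ∷-injectiveˡ; ∷-injectiveʳ)
open import Data.List.Relation.Unary.All using (All; []; _∷_)
open import Data.Maybe using (Maybe; just; nothing; is-just; fromMaybe)
open import Data.Maybe.Properties using (just-injective; ≡-dec)
open import Data.Nat using (ℕ; zero; suc; pred; _<?_; _+_; _*_; _∸_; _⊔_; _≤_; _<_; _≡ᵇ_; z≤n; s≤s)
open import Data.Nat.Properties using (suc-injective; ≤-trans; ≤-reflexive; m≥n⇒m⊔n≡m; m≤m+n; m≤m⊔n; m≤n⊔m; ⊔-identityʳ; ⊔-assoc; ⊔-lub)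
open import Data.Product using (Σ; ∃; _×_; _,_; proj₁; proj₂; map₁; map₂)
open import Data.Product.Function.NonDependent.Propositional using (_×-↔_; _×-⇔_)
open import Data.Sum using (_⊎_; inj₁; inj₂)
open import Data.Sum.Function.Propositional using (_⊎-↔_; _⊎-⇔_)
open import Data.Unit using (⊤; tt)
open import Data.Empty using (⊥; ⊥-elim)
open import Data.Vec using (Vec; []; _∷_; lookup; tabulate)
open import Data.Vec.Properties using (lookup∘tabulate)
open import Function using (_∘_; id)
open import Function.Construct.Identity using (⇔-id)
open import Function.Bundles using (_⇔_; _↔_; mk⇔; mk↔ₛ′; Equivalence; Inverse)
open import Function.Construct.Composition using (_⇔-∘_)
open import Function.Construct.Symmetry using (⇔-sym)
open import Function.Properties.Inverse using (↔-refl; ↔-sym; ↔-trans)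
open import Relation.Binary.PropositionalEquality using (_≡_; refl; sym; trans; cong; cong₂; subst; subst₂; module ≡-Reasoning)
open import Relation.Nullary using (Dec; yes; no; ¬_)
open import Relation.Nullary.Decidable using (⌊_⌋; toWitness; fromWitness; _×-dec_; T?; decidable-stable)
import Relation.Nullary.Decidable as Decidable

open import Defs

open Equivalence using (to; from)

private
  variable
    A B Q R : Set
    P P′ : List A → Set

Finite : Set → Set
Finite Q = Σ ℕ λ n → Q ↔ Fin n

finite-Fin : ∀ n → Finite (Fin n)
finite-Fin n = n , ↔-refl

finite-⊤ : Finite ⊤
finite-⊤ = 1 , ↔-sym 1↔⊤

finite-Bool : Finite Bool
finite-Bool = 2 , ↔-sym 2↔Bool

finite-× : Finite Q → Finite R → Finite (Q × R)
finite-× (m , f) (n , g) = m * n , ↔-trans (f ×-↔ g) (↔-sym *↔×)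

Maybe↔⊤⊎ : Maybe A ↔ (⊤ ⊎ A)
Maybe↔⊤⊎ = mk↔ₛ′ fwd bwd (λ { (inj₁ tt) → refl ; (inj₂ a) → refl }) (λ { nothing → refl ; (just a) → refl })
  where
  fwd : Maybe _ → ⊤ ⊎ _
  fwd nothing  = inj₁ tt
  fwd (just a) = inj₂ a
  bwd : ⊤ ⊎ _ → Maybe _
  bwd (inj₁ tt) = nothing
  bwd (inj₂ a)  = just a

finite-Maybe : Finite Q → Finite (Maybe Q)
finite-Maybe (n , f) = suc n , ↔-trans Maybe↔⊤⊎ (↔-trans (↔-sym 1↔⊤ ⊎-↔ f) (↔-sym +↔⊎))

Vec↔× : ∀ {n} → Vec A (suc n) ↔ (A × Vec A n)
Vec↔× = mk↔ₛ′ (λ { (a ∷ as) → a , as }) (λ { (a , as) → a ∷ as }) (λ _ → refl) (λ { (a ∷ as) → refl })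

finite-Vec : Finite Q → ∀ n → Finite (Vec Q n)
finite-Vec fin zero    = 1 , mk↔ₛ′ (λ _ → zero) (λ _ → []) (λ { zero → refl }) (λ { [] → refl })
finite-Vec fin (suc n) = let (m , g) = finite-× fin (finite-Vec fin n) in m , ↔-trans Vec↔× g

size : Finite Q → ℕ
size = proj₁

encode : (fin : Finite Q) → Q → Fin (size fin)
encode fin = Inverse.to (proj₂ fin)

decode : (fin : Finite Q) → Fin (size fin) → Q
decode fin = Inverse.from (proj₂ fin)

decode-encode : (fin : Finite Q) (q : Q) → decode fin (encode fin q) ≡ q
decode-encode fin = Inverse.strictlyInverseʳ (proj₂ fin)

encode-decode : (fin : Finite Q) (i : Fin (size fin)) → encode fin (decode fin i) ≡ i
encode-decode fin = Inverse.strictlyInverseˡ (proj₂ fin)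

encode-injective : (fin : Finite Q) {q q′ : Q} → encode fin q ≡ encode fin q′ → q ≡ q′
encode-injective fin {q} {q′} e = trans (sym (decode-encode fin q)) (trans (cong (decode fin) e) (decode-encode fin q′))

finite-SymTup : Finite A → ∀ a → Finite (Tens A a)
finite-SymTup fin zero    = finite-⊤
finite-SymTup fin (suc a) = finite-× (finite-Maybe fin) (finite-SymTup fin a)

-- Automata and regular languages

record Automaton (A : Set) : Set₁ where
  field
    State     : Set
    finite    : Finite State
    start     : State
    step      : State → A → State
    accepting : State → Bool

open Automaton

run : (M : Automaton A) → State M → List A → State M
run M = foldl (step M)

accepts : Automaton A → List A → Bool
accepts M xs = accepting M (run M (start M) xs)

Recognizes : Automaton A → (List A → Set) → Set
Recognizes M P = ∀ xs → IsTrue (accepts M xs) ⇔ P xs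

Regular : (A : Set) → (List A → Set) → Set₁
Regular A P = Σ (Automaton A) λ M → Recognizes M P

toDFA : Automaton A → DFA A
toDFA M = record
  { nQ = size (finite M) ; start = encode (finite M) (start M)
  ; δ = λ i a → encode (finite M) (step M (decode (finite M) i) a) ; acc = accepting M ∘ decode (finite M) }

runDFA-toDFA : (M : Automaton A) (q : State M) (xs : List A) →
               runDFA (toDFA M) (encode (finite M) q) xs ≡ encode (finite M) (run M q xs)
runDFA-toDFA M q []       = refl
runDFA-toDFA M q (x ∷ xs) rewrite decode-encode (finite M) q = runDFA-toDFA M (step M q x) xs

AcceptsDFA-toDFA : (M : Automaton A) (xs : List A) → AcceptsDFA (toDFA M) xs ⇔ IsTrue (accepts M xs)
AcceptsDFA-toDFA M xs rewrite runDFA-toDFA M (start M) xs | decode-encode (finite M) (run M (start M) xs) =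
  ⇔-sym T-≡

≡⇒⇔ : {X Y : Set} → X ≡ Y → X ⇔ Y
≡⇒⇔ refl = ⇔-id _

isTrue-⌊⌋ : {X : Set} (d : Dec X) → IsTrue ⌊ d ⌋ ⇔ X
isTrue-⌊⌋ d = mk⇔ toWitness fromWitness

isTrue-not : ∀ {b} → IsTrue (not b) ⇔ (¬ IsTrue b)
isTrue-not {true}  = mk⇔ (λ ()) (λ f → f tt)
isTrue-not {false} = mk⇔ (λ _ ()) (λ _ → tt)

Regular-resp : (∀ xs → P xs ⇔ P′ xs) → Regular A P → Regular A P′
Regular-resp e (M , h) = M , λ xs → e xs ⇔-∘ h xs

Regular-dec : Regular A P → ∀ xs → Dec (P xs)
Regular-dec (M , h) xs = Decidable.map (h xs) (T? (accepts M xs))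

Regular-const : {X : Set} → Dec X → Regular A (λ _ → X)
Regular-const d = record { State = ⊤ ; finite = finite-⊤ ; start = tt ; step = λ _ _ → tt ; accepting = λ _ → ⌊ d ⌋ }
                , λ _ → isTrue-⌊⌋ d

comap : (B → A) → Automaton A → Automaton B
comap f M = record
  { State = State M ; finite = finite M ; start = start M ; step = λ q b → step M q (f b) ; accepting = accepting M }

run-comap : (f : B → A) (M : Automaton A) (q : State M) (xs : List B) →
            run (comap f M) q xs ≡ run M q (map f xs)
run-comap f M q []       = refl
run-comap f M q (x ∷ xs) = run-comap f M (step M q (f x)) xs

Regular-comap : (f : B → A) → Regular A P → Regular B (P ∘ map f)
Regular-comap f (M , h) = comap f M , λ xs →
  subst (λ q → IsTrue (accepting M q) ⇔ _) (sym (run-comap f M (start M) xs)) (h (map f xs))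

complement : Automaton A → Automaton A
complement M = record M { accepting = not ∘ accepting M }

Regular-¬ : Regular A P → Regular A (¬_ ∘ P)
Regular-¬ (M , h) = complement M , λ xs →
  mk⇔ (λ t p → to isTrue-not t (from (h xs) p)) (λ np → from isTrue-not (np ∘ to (h xs)))

product : (Bool → Bool → Bool) → Automaton A → Automaton A → Automaton A
product _⊕_ M N = record
  { State = State M × State N ; finite = finite-× (finite M) (finite N) ; start = start M , start N
  ; step = λ (p , q) a → step M p a , step N q a ; accepting = λ (p , q) → accepting M p ⊕ accepting N q }

run-product : ∀ _⊕_ (M N : Automaton A) p q xs → run (product _⊕_ M N) (p , q) xs ≡ (run M p xs , run N q xs)
run-product _⊕_ M N p q []       = refl
run-product _⊕_ M N p q (x ∷ xs) = run-product _⊕_ M N (step M p x) (step N q x) xs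

accepts-product : ∀ _⊕_ (M N : Automaton A) xs → accepts (product _⊕_ M N) xs ≡ (accepts M xs ⊕ accepts N xs)
accepts-product _⊕_ M N xs = cong (λ (p , q) → accepting M p ⊕ accepting N q) (run-product _⊕_ M N _ _ xs)

Regular-× : Regular A P → Regular A P′ → Regular A (λ xs → P xs × P′ xs)
Regular-× (M , h) (N , h′) = product _∧_ M N , λ xs →
  subst (λ b → IsTrue b ⇔ _) (sym (accepts-product _∧_ M N xs)) ((h xs ×-⇔ h′ xs) ⇔-∘ T-∧)

Regular-⊎ : Regular A P → Regular A P′ → Regular A (λ xs → P xs ⊎ P′ xs)
Regular-⊎ (M , h) (N , h′) = product _∨_ M N , λ xs →
  subst (λ b → IsTrue b ⇔ _) (sym (accepts-product _∨_ M N xs)) ((h xs ⊎-⇔ h′ xs) ⇔-∘ T-∨)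

everyLetter : {Q : A → Set} → (∀ a → Dec (Q a)) → Automaton A
everyLetter Q? = record
  { State = Bool ; finite = finite-Bool ; start = true ; step = λ b a → b ∧ ⌊ Q? a ⌋ ; accepting = λ b → b }

run-everyLetter : {Q : A → Set} (Q? : ∀ a → Dec (Q a)) (b : Bool) (xs : List A) →
                  IsTrue (run (everyLetter Q?) b xs) ⇔ (IsTrue b × All Q xs)
run-everyLetter Q? b []       = mk⇔ (_, []) proj₁
run-everyLetter Q? b (x ∷ xs) = mk⇔
  (λ t → let (t′ , qs) = to (run-everyLetter Q? (b ∧ ⌊ Q? x ⌋) xs) t ; (tb , q) = to T-∧ t′ in tb , toWitness q ∷ qs)
  (λ { (tb , q ∷ qs) → from (run-everyLetter Q? (b ∧ ⌊ Q? x ⌋) xs) (from T-∧ (tb , fromWitness q) , qs) })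

Regular-All : {Q : A → Set} → (∀ a → Dec (Q a)) → Regular A (All Q)
Regular-All Q? = everyLetter Q? , λ xs →
  mk⇔ (proj₂ ∘ to (run-everyLetter Q? true xs)) (from (run-everyLetter Q? true xs) ∘ (tt ,_))

module Projection (finB : Finite B) (M : Automaton (A × B)) where
  private
    finQ = finite M
    N = size finQ

  Subset : Set
  Subset = Vec Bool N

  _∈ₛ_ : State M → Subset → Set
  q ∈ₛ S = IsTrue (lookup S (encode finQ q))

  ∈-tabulate : ∀ {q} (f : Fin N → Bool) → q ∈ₛ tabulate f ⇔ IsTrue (f (encode finQ q))
  ∈-tabulate {q} f = subst (λ b → IsTrue b ⇔ IsTrue (f (encode finQ q))) (sym (lookup∘tabulate f (encode finQ q))) (⇔-id _)

  successor? : (S : Subset) (a : A) (j : Fin N) →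
    Dec (∃ λ i → IsTrue (lookup S i) × ∃ λ c → encode finQ (step M (decode finQ i) (a , decode finB c)) ≡ j)
  successor? S a j = any? λ i → T? (lookup S i) ×-dec any? λ c → encode finQ (step M (decode finQ i) (a , decode finB c)) ≟ᶠ j

  stepₛ : Subset → A → Subset
  stepₛ S a = tabulate λ j → ⌊ successor? S a j ⌋

  acceptingₛ : Subset → Bool
  acceptingₛ S = ⌊ any? (λ i → T? (lookup S i) ×-dec T? (accepting M (decode finQ i))) ⌋

  subsetAutomaton : Automaton A
  subsetAutomaton = record
    { State = Subset ; finite = finite-Vec finite-Bool N ; start = tabulate λ j → ⌊ encode finQ (start M) ≟ᶠ j ⌋
    ; step = stepₛ ; accepting = acceptingₛ }

  ∈-stepₛ : ∀ S a {q′} → q′ ∈ₛ stepₛ S a ⇔ (∃ λ q → q ∈ₛ S × ∃ λ b → step M q (a , b) ≡ q′)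
  ∈-stepₛ S a {q′} = mk⇔ sound complete ⇔-∘ ∈-tabulate _
    where
    sound : IsTrue ⌊ successor? S a (encode finQ q′) ⌋ → _
    sound t with toWitness t
    ... | i , i∈S , c , e = decode finQ i , subst (IsTrue ∘ lookup S) (sym (encode-decode finQ i)) i∈S
                          , decode finB c , encode-injective finQ e
    complete : _ → IsTrue ⌊ successor? S a (encode finQ q′) ⌋
    complete (q , q∈S , b , refl) = fromWitness
      ( encode finQ q , q∈S , encode finB b
      , cong (λ (q , b) → encode finQ (step M q (a , b))) (cong₂ _,_ (decode-encode finQ q) (decode-encode finB b)))

  ∈-start : ∀ {q} → q ∈ₛ start subsetAutomaton ⇔ (start M ≡ q)
  ∈-start = (mk⇔ (encode-injective finQ) (cong (encode finQ)) ⇔-∘ isTrue-⌊⌋ _) ⇔-∘ ∈-tabulate _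

  isTrue-acceptingₛ : ∀ S → IsTrue (acceptingₛ S) ⇔ (∃ λ q → q ∈ₛ S × IsTrue (accepting M q))
  isTrue-acceptingₛ S = mk⇔
    (λ { (i , i∈S , acc) → decode finQ i , subst (IsTrue ∘ lookup S) (sym (encode-decode finQ i)) i∈S , acc })
    (λ { (q , q∈S , acc) → encode finQ q , q∈S , subst (IsTrue ∘ accepting M) (sym (decode-encode finQ q)) acc })
    ⇔-∘ isTrue-⌊⌋ _

  ∈-run : ∀ S xs {q′} → q′ ∈ₛ run subsetAutomaton S xs ⇔
          (∃ λ q → q ∈ₛ S × ∃ λ bs → length bs ≡ length xs × run M q (zip xs bs) ≡ q′)
  ∈-run S [] {q′} = mk⇔ (λ q′∈S → q′ , q′∈S , [] , refl , refl) (λ { (q , q∈S , [] , _ , refl) → q∈S })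
  ∈-run S (a ∷ xs) {q′} = mk⇔
    (λ q′∈ → let (q₁ , q₁∈ , bs , lbs , e) = to (∈-run (stepₛ S a) xs) q′∈
                 (q , q∈S , b , e₁) = to (∈-stepₛ S a) q₁∈
             in q , q∈S , b ∷ bs , cong suc lbs , subst (λ q₁ → run M q₁ (zip xs bs) ≡ q′) (sym e₁) e)
    (λ { (q , q∈S , b ∷ bs , lbs , e) →
         from (∈-run (stepₛ S a) xs) (step M q (a , b) , from (∈-stepₛ S a) (q , q∈S , b , refl) , bs , suc-injective lbs , e) })

  recognizes-subsetAutomaton : Recognizes M P →
    Recognizes subsetAutomaton (λ xs → ∃ λ bs → length bs ≡ length xs × P (zip xs bs))
  recognizes-subsetAutomaton h xs = mk⇔
    (λ t → let (q′ , q′∈ , acc) = to (isTrue-acceptingₛ (run subsetAutomaton Sₒ xs)) t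
               (q , q∈ , bs , lbs , e) = to (∈-run Sₒ xs) q′∈
               start≡q = to ∈-start q∈
           in bs , lbs , to (h (zip xs bs)) (subst (λ q → IsTrue (accepting M (run M q (zip xs bs)))) (sym start≡q)
                                              (subst (IsTrue ∘ accepting M) (sym e) acc)))
    (λ (bs , lbs , p) → from (isTrue-acceptingₛ (run subsetAutomaton Sₒ xs))
       (_ , from (∈-run Sₒ xs) (start M , from ∈-start refl , bs , lbs , refl) , from (h (zip xs bs)) p))
    where Sₒ = start subsetAutomaton

Regular-∃ : Finite B → Regular (A × B) P → Regular A (λ xs → ∃ λ bs → length bs ≡ length xs × P (zip xs bs))
Regular-∃ finB (M , h) = subsetAutomaton , recognizes-subsetAutomaton h
  where open Projection finB M

map-proj₁-zip : (xs : List A) (ys : List B) → length xs ≡ length ys → map proj₁ (zip xs ys) ≡ xs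
map-proj₁-zip []       []       _ = refl
map-proj₁-zip (x ∷ xs) (y ∷ ys) e = cong (x ∷_) (map-proj₁-zip xs ys (suc-injective e))

map-proj₂-zip : (xs : List A) (ys : List B) → length xs ≡ length ys → map proj₂ (zip xs ys) ≡ ys
map-proj₂-zip []       []       _ = refl
map-proj₂-zip (x ∷ xs) (y ∷ ys) e = cong (y ∷_) (map-proj₂-zip xs ys (suc-injective e))

map-proj-injective : {ys zs : List (A × B)} → map proj₁ ys ≡ map proj₁ zs → map proj₂ ys ≡ map proj₂ zs → ys ≡ zs
map-proj-injective {ys = []}     {[]}     _  _  = refl
map-proj-injective {ys = y ∷ ys} {z ∷ zs} e₁ e₂ =
  cong₂ _∷_ (cong₂ _,_ (∷-injectiveˡ e₁) (∷-injectiveˡ e₂)) (map-proj-injective (∷-injectiveʳ e₁) (∷-injectiveʳ e₂))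

zip≡⇔ : (xs : List A) (ys : List B) (zs : List (A × B)) → length xs ≡ length ys →
        (zip xs ys ≡ zs) ⇔ (xs ≡ map proj₁ zs × ys ≡ map proj₂ zs)
zip≡⇔ xs ys zs e = mk⇔
  (λ { refl → sym (map-proj₁-zip xs ys e) , sym (map-proj₂-zip xs ys e) })
  (λ (e₁ , e₂) → map-proj-injective (trans (map-proj₁-zip xs ys e) e₁) (trans (map-proj₂-zip xs ys e) e₂))

map-map₁-zip : (f : A → B) (xs : List A) (ys : List R) → map (map₁ f) (zip xs ys) ≡ zip (map f xs) ys
map-map₁-zip f xs ys = trans (sym (zip-map f id xs ys)) (cong (zip (map f xs)) (map-id ys))

map-map₂-zip : (f : B → R) (xs : List A) (ys : List B) → map (map₂ f) (zip xs ys) ≡ zip xs (map f ys)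
map-map₂-zip f xs ys = trans (sym (zip-map id f xs ys)) (cong (λ xs → zip xs (map f ys)) (map-id xs))

List⊤-≡ : {xs ys : List ⊤} → length xs ≡ length ys → xs ≡ ys
List⊤-≡ {[]}     {[]}     _ = refl
List⊤-≡ {_ ∷ xs} {_ ∷ ys} e = cong (tt ∷_) (List⊤-≡ (suc-injective e))

length-zip : (xs : List A) (ys : List B) → length xs ≡ length ys → length (zip xs ys) ≡ length xs
length-zip []       []       _ = refl
length-zip (x ∷ xs) (y ∷ ys) e = cong suc (length-zip xs ys (suc-injective e))

All-≡⇔map-≡ : {f g : A → B} (xs : List A) → All (λ x → f x ≡ g x) xs ⇔ (map f xs ≡ map g xs)
All-≡⇔map-≡ xs = mk⇔ map-cong-local (complete xs)
  where
  complete : ∀ xs → map _ xs ≡ map _ xs → All _ xs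
  complete []       _ = []
  complete (x ∷ xs) e = ∷-injectiveˡ e ∷ complete xs (∷-injectiveʳ e)

-- Padding

padTo : ℕ → List A → List (Maybe A)
padTo zero    u = []
padTo (suc k) u = Data.List.head u ∷ padTo k (drop 1 u)

unpad : List (Maybe A) → List A
unpad (just x ∷ h) = x ∷ unpad h
unpad _            = []

IsPadded : List (Maybe A) → Set
IsPadded h = ∃ λ u → ∃ λ m → 0 < length u × h ≡ map just u ++ replicate m nothing

AllJust : List (Maybe A) → Set
AllJust = All (IsTrue ∘ is-just)

length-padTo : ∀ k (u : List A) → length (padTo k u) ≡ k
length-padTo zero    u = refl
length-padTo (suc k) u = cong suc (length-padTo k (drop 1 u))

padTo-[] : ∀ k → padTo {A} k [] ≡ replicate k nothing
padTo-[] zero    = refl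
padTo-[] (suc k) = cong (nothing ∷_) (padTo-[] k)

padTo≡pad : ∀ k (u : List A) → length u ≤ k → padTo k u ≡ pad k u
padTo≡pad zero    []      _         = refl
padTo≡pad (suc k) []      _         = cong (nothing ∷_) (padTo-[] k)
padTo≡pad (suc k) (x ∷ u) (s≤s |u|≤k) = cong (just x ∷_) (padTo≡pad k u |u|≤k)

unpad-padTo : ∀ k (u : List A) → length u ≤ k → unpad (padTo k u) ≡ u
unpad-padTo zero    []      _           = refl
unpad-padTo (suc k) []      _           = refl
unpad-padTo (suc k) (x ∷ u) (s≤s |u|≤k) = cong (x ∷_) (unpad-padTo k u |u|≤k)

padTo-length : (u : List A) → padTo (length u) u ≡ map just u
padTo-length []      = refl
padTo-length (x ∷ u) = cong (just x ∷_) (padTo-length u)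

unpad-pad : ∀ k (u : List A) → length u ≤ k → unpad (pad k u) ≡ u
unpad-pad k u |u|≤k = trans (cong unpad (sym (padTo≡pad k u |u|≤k))) (unpad-padTo k u |u|≤k)

padTo-injective : ∀ k {u v : List A} → length u ≤ k → length v ≤ k → padTo k u ≡ padTo k v → u ≡ v
padTo-injective k {u} {v} |u|≤k |v|≤k e =
  trans (sym (unpad-padTo k u |u|≤k)) (trans (cong unpad e) (unpad-padTo k v |v|≤k))

unpad-padded : (u : List A) (m : ℕ) → unpad (map just u ++ replicate m nothing) ≡ u
unpad-padded []      zero    = refl
unpad-padded []      (suc m) = refl
unpad-padded (x ∷ u) m       = cong (x ∷_) (unpad-padded u m)

length-padded : (u : List A) (m : ℕ) → length (map just u ++ replicate m nothing) ≡ length u + m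
length-padded u m = trans (length-++ (map just u)) (cong₂ _+_ (length-map just u) (length-replicate m))

padTo-padded : (u : List A) (m : ℕ) → padTo (length u + m) u ≡ map just u ++ replicate m nothing
padTo-padded []      m = padTo-[] m
padTo-padded (x ∷ u) m = cong (just x ∷_) (padTo-padded u m)

padTo-unpad : (h : List (Maybe A)) → IsPadded h → padTo (length h) (unpad h) ≡ h
padTo-unpad _ (u , m , _ , refl) rewrite length-padded u m | unpad-padded u m = padTo-padded u m

unpad-bounds : (h : List (Maybe A)) → IsPadded h → 0 < length (unpad h) × length (unpad h) ≤ length h
unpad-bounds _ (u , m , 0<|u| , refl) rewrite length-padded u m | unpad-padded u m = 0<|u| , m≤m+n (length u) m

isPadded-padTo : ∀ k (u : List A) → 0 < length u → length u ≤ k → IsPadded (padTo k u)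
isPadded-padTo k u 0<|u| |u|≤k = u , k ∸ length u , 0<|u| , padTo≡pad k u |u|≤k

unpad-map-just : (u : List A) → unpad (map just u) ≡ u
unpad-map-just []      = refl
unpad-map-just (x ∷ u) = cong (x ∷_) (unpad-map-just u)

allJust-map-just : (u : List A) → AllJust (map just u)
allJust-map-just []      = []
allJust-map-just (x ∷ u) = tt ∷ allJust-map-just u

map-just-unpad : (h : List (Maybe A)) → AllJust h → map just (unpad h) ≡ h
map-just-unpad []           []      = refl
map-just-unpad (just x ∷ h) (_ ∷ j) = cong (just x ∷_) (map-just-unpad h j)

map-fromMaybe : (d : A) (h : List (Maybe A)) → AllJust h → map (fromMaybe d) h ≡ unpad h
map-fromMaybe d []           []      = refl
map-fromMaybe d (just x ∷ h) (_ ∷ j) = cong (x ∷_) (map-fromMaybe d h j)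

length-unpad : (h : List (Maybe A)) → AllJust h → length (unpad h) ≡ length h
length-unpad h j = trans (sym (length-map just (unpad h))) (cong length (map-just-unpad h j))

data PaddingPhase : Set where
  initial letters padding failed : PaddingPhase

finite-PaddingPhase : Finite PaddingPhase
finite-PaddingPhase = 4 , mk↔ₛ′ enc dec
  (λ { zero → refl ; (suc zero) → refl ; (suc (suc zero)) → refl ; (suc (suc (suc zero))) → refl })
  (λ { initial → refl ; letters → refl ; padding → refl ; failed → refl })
  where
  enc : PaddingPhase → Fin 4
  enc initial = zero
  enc letters = suc zero
  enc padding = suc (suc zero)
  enc failed  = suc (suc (suc zero))
  dec : Fin 4 → PaddingPhase
  dec zero                   = initial
  dec (suc zero)             = letters
  dec (suc (suc zero))       = padding
  dec (suc (suc (suc zero))) = failed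

paddingStep : PaddingPhase → Maybe A → PaddingPhase
paddingStep initial (just _) = letters
paddingStep letters (just _) = letters
paddingStep letters nothing  = padding
paddingStep padding nothing  = padding
paddingStep _       _        = failed

paddingAccepting : PaddingPhase → Bool
paddingAccepting letters = true
paddingAccepting padding = true
paddingAccepting _       = false

paddedAutomaton : Automaton (Maybe A)
paddedAutomaton = record
  { State = PaddingPhase ; finite = finite-PaddingPhase ; start = initial ; step = paddingStep ; accepting = paddingAccepting }

module _ {A : Set} where
  private
    accepts-from : PaddingPhase → List (Maybe A) → Set
    accepts-from q h = IsTrue (paddingAccepting (run paddedAutomaton q h))

  run-failed : (h : List (Maybe A)) → run paddedAutomaton failed h ≡ failed
  run-failed []      = refl
  run-failed (_ ∷ h) = run-failed h

  accepts-padding : (h : List (Maybe A)) → accepts-from padding h ⇔ (h ≡ replicate (length h) nothing)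
  accepts-padding h = mk⇔ (sound h) complete
    where
    sound : (h : List (Maybe A)) → accepts-from padding h → h ≡ replicate (length h) nothing
    sound []            t = refl
    sound (nothing ∷ h) t = cong (nothing ∷_) (sound h t)
    sound (just x ∷ h)  t rewrite run-failed h = ⊥-elim t
    complete : ∀ {h} → h ≡ replicate (length h) nothing → accepts-from padding h
    complete {[]}          _ = tt
    complete {nothing ∷ h} e = complete (∷-injectiveʳ e)

  accepts-letters : (h : List (Maybe A)) → accepts-from letters h ⇔ (∃ λ u → ∃ λ m → h ≡ map just u ++ replicate m nothing)
  accepts-letters h = mk⇔ (sound h) (λ (u , m , e) → subst (accepts-from letters) (sym e) (complete u m))
    where
    sound : (h : List (Maybe A)) → accepts-from letters h → ∃ λ u → ∃ λ m → h ≡ map just u ++ replicate m nothing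
    sound []            t = [] , 0 , refl
    sound (just x ∷ h)  t = let (u , m , e) = sound h t in x ∷ u , m , cong (just x ∷_) e
    sound (nothing ∷ h) t = [] , suc (length h) , cong (nothing ∷_) (to (accepts-padding h) t)
    complete : (u : List A) (m : ℕ) → accepts-from letters (map just u ++ replicate m nothing)
    complete []      zero    = tt
    complete []      (suc m) =
      from (accepts-padding (replicate m nothing)) (cong (λ k → replicate k nothing) (sym (length-replicate m)))
    complete (x ∷ u) m       = complete u m

  Regular-IsPadded : Regular (Maybe A) IsPadded
  Regular-IsPadded = paddedAutomaton , λ h → mk⇔ (sound h) (complete h)
    where
    sound : (h : List (Maybe A)) → IsTrue (accepts paddedAutomaton h) → IsPadded h
    sound (just x ∷ h)  t = let (u , m , e) = to (accepts-letters h) t in x ∷ u , m , s≤s z≤n , cong (just x ∷_) e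
    sound (nothing ∷ h) t rewrite run-failed h = ⊥-elim t
    complete : (h : List (Maybe A)) → IsPadded h → IsTrue (accepts paddedAutomaton h)
    complete _ (x ∷ u , m , _ , refl) = from (accepts-letters _) (u , m , refl)

-- Ordered decision diagrams

AcceptingPath : {w : ℕ} → List (Layer A w) → List (Maybe A) → Set
AcceptingPath {w = w} D σs = ∃ λ (p : Fin w) → ∃ λ (q : Fin w) → firstI D p ≡ true × lastF D q ≡ true × Path D σs p q

-- A state records the ODD states reachable at the right boundary of the layers read so far,
-- and whether one of them is final there.
module PathSimulation (A : Set) (w : ℕ) where
  image : Vec Bool w → Layer A w → Maybe A → Vec Bool w
  image S B σ = tabulate λ q → ⌊ any? (λ p → T? (lookup S p) ×-dec T? (T B p σ q)) ⌋

  finalReached? : ∀ S B σ → Dec (∃ λ q → IsTrue (lookup (image S B σ) q) × IsTrue (F B q))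
  finalReached? S B σ = any? λ q → T? (lookup (image S B σ) q) ×-dec T? (F B q)

  afterLayer : Vec Bool w → Layer A w → Maybe A → Maybe (Vec Bool w × Bool)
  afterLayer S B σ = just (image S B σ , ⌊ finalReached? S B σ ⌋)

  stepₚ : Maybe (Vec Bool w × Bool) → Layer A w × Maybe A → Maybe (Vec Bool w × Bool)
  stepₚ nothing        (B , σ) = afterLayer (tabulate (I B)) B σ
  stepₚ (just (S , _)) (B , σ) = afterLayer S B σ

  acceptingₚ : Maybe (Vec Bool w × Bool) → Bool
  acceptingₚ nothing        = false
  acceptingₚ (just (_ , f)) = f

  pathAutomaton : Automaton (Layer A w × Maybe A)
  pathAutomaton = record
    { State = Maybe (Vec Bool w × Bool) ; finite = finite-Maybe (finite-× (finite-Vec finite-Bool w) finite-Bool)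
    ; start = nothing ; step = stepₚ ; accepting = acceptingₚ }

  ∈-tabulate : (f : Fin w → Bool) (q : Fin w) → IsTrue (lookup (tabulate f) q) ⇔ (f q ≡ true)
  ∈-tabulate f q = subst (λ b → IsTrue b ⇔ (f q ≡ true)) (sym (lookup∘tabulate f q)) T-≡

  ∈-image : ∀ S B σ q → IsTrue (lookup (image S B σ) q) ⇔ (∃ λ p → IsTrue (lookup S p) × T B p σ q ≡ true)
  ∈-image S B σ q =
    mk⇔ (λ (p , s , t) → p , s , to T-≡ t) (λ (p , s , t) → p , s , from T-≡ t) ⇔-∘ (isTrue-⌊⌋ _ ⇔-∘ ∈-tabulate′)
    where ∈-tabulate′ = subst (λ b → IsTrue (lookup (image S B σ) q) ⇔ IsTrue b) (lookup∘tabulate _ q) (⇔-id _)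

  run-afterLayer : ∀ S B σ z → IsTrue (acceptingₚ (run pathAutomaton (afterLayer S B σ) z)) ⇔
    (∃ λ p → ∃ λ q → IsTrue (lookup S p) × lastF (B ∷ map proj₁ z) q ≡ true × Path (B ∷ map proj₁ z) (σ ∷ map proj₂ z) p q)
  run-afterLayer S B σ [] = mk⇔
    (λ t → let (q , q∈ , fin) = to (isTrue-⌊⌋ (finalReached? S B σ)) t
               (p , p∈ , tr)  = to (∈-image S B σ q) q∈
           in p , q , p∈ , to T-≡ fin , q , tr , refl)
    (λ { (p , q , p∈ , fin , .q , tr , refl) →
         from (isTrue-⌊⌋ (finalReached? S B σ)) (q , from (∈-image S B σ q) (p , p∈ , tr) , from T-≡ fin) })
  run-afterLayer S B σ ((B′ , σ′) ∷ z) = mk⇔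
    (λ t → let (p₁ , q , p₁∈ , fin , path) = to ih t ; (p , p∈ , tr) = to (∈-image S B σ p₁) p₁∈
           in p , q , p∈ , fin , p₁ , tr , path)
    (λ (p , q , p∈ , fin , p₁ , tr , path) → from ih (p₁ , q , from (∈-image S B σ p₁) (p , p∈ , tr) , fin , path))
    where ih = run-afterLayer (image S B σ) B′ σ′ z

  recognizes-pathAutomaton : Recognizes pathAutomaton (λ z → AcceptingPath (map proj₁ z) (map proj₂ z))
  recognizes-pathAutomaton []            = mk⇔ (λ ()) (λ { (_ , _ , () , _) })
  recognizes-pathAutomaton ((B , σ) ∷ z) = mk⇔
    (λ t → let (p , q , p∈ , fin , path) = to (run-afterLayer (tabulate (I B)) B σ z) t
           in p , q , to (∈-tabulate (I B) p) p∈ , fin , path)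
    (λ (p , q , ini , fin , path) →
       from (run-afterLayer (tabulate (I B)) B σ z) (p , q , from (∈-tabulate (I B) p) ini , fin , path))

Regular-AcceptingPath : (A : Set) (w : ℕ) → Regular (Layer A w × Maybe A) (λ z → AcceptingPath (map proj₁ z) (map proj₂ z))
Regular-AcceptingPath A w = pathAutomaton , recognizes-pathAutomaton
  where open PathSimulation A w

accepts⇔path : {w : ℕ} (D : List (Layer A w)) (h : List (Maybe A)) → IsPadded h → length h ≡ length D →
               AcceptsODD D (unpad h) ⇔ AcceptingPath D h
accepts⇔path D h padded |h|≡|D| = mk⇔
  (λ (_ , _ , p , q , ini , fin , path) → p , q , ini , fin , subst (λ σs → Path D σs p q) pad≡h path)
  (λ (p , q , ini , fin , path) → proj₁ bounds , |u|≤|D| , p , q , ini , fin , subst (λ σs → Path D σs p q) (sym pad≡h) path)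
  where
  bounds = unpad-bounds h padded
  |u|≤|D| : length (unpad h) ≤ length D
  |u|≤|D| = subst (length (unpad h) ≤_) |h|≡|D| (proj₂ bounds)
  pad≡h : pad (length D) (unpad h) ≡ h
  pad≡h = trans (sym (padTo≡pad (length D) (unpad h) |u|≤|D|))
                (subst (λ k → padTo k (unpad h) ≡ h) |h|≡|D| (padTo-unpad h padded))

accepts⇒path : {w : ℕ} (D : List (Layer A w)) (u : List A) → AcceptsODD D u → AcceptingPath D (padTo (length D) u)
accepts⇒path D u (_ , |u|≤|D| , p , q , ini , fin , path) =
  p , q , ini , fin , subst (λ σs → Path D σs p q) (sym (padTo≡pad (length D) u |u|≤|D|)) path

accepts⇔padded-path : {w : ℕ} (D : List (Layer A w)) (x : List A) → length x ≤ length D →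
                      AcceptsODD D x ⇔ (0 < length x × AcceptingPath D (pad (length D) x))
accepts⇔padded-path D x |x|≤|D| = mk⇔ (λ (pos , _ , path) → pos , path) (λ (pos , path) → pos , |x|≤|D| , path)

Chain : {w : ℕ} → Layer A w → List (Layer A w) → Set
Chain B []        = φ B ≡ true
Chain B (B′ ∷ Bs) = φ B ≡ false × ι B′ ≡ false × (∀ p → ℓ B′ p ≡ r B p) × Chain B′ Bs

WellFormed : {w : ℕ} → List (Layer A w) → Set
WellFormed []       = ⊥
WellFormed (B ∷ Bs) = ι B ≡ true × Chain B Bs

InnerFlags : {w : ℕ} → List (Layer A w) → Set
InnerFlags Bs = (j : Fin (length Bs)) →
  ι (Data.List.lookup Bs j) ≡ false × φ (Data.List.lookup Bs j) ≡ (suc (toℕ j) ≡ᵇ length Bs)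

chain⇔ : {w : ℕ} (B : Layer A w) (Bs : List (Layer A w)) →
         Chain B Bs ⇔ (φ B ≡ (0 ≡ᵇ length Bs) × InnerFlags Bs × Adjacent (B ∷ Bs))
chain⇔ B [] = mk⇔ (λ c → c , (λ ()) , tt) proj₁
chain⇔ B (B′ ∷ Bs) = mk⇔
  (λ (f , i , a , c) → let (f′ , flags , adj) = to (chain⇔ B′ Bs) c
                       in f , (λ { zero → i , f′ ; (suc j) → flags j }) , a , adj)
  (λ (f , flags , a , adj) → f , proj₁ (flags zero) , a , from (chain⇔ B′ Bs) (proj₂ (flags zero) , flags ∘ suc , adj))

IsODD-length⇔WellFormed : {w : ℕ} (D : List (Layer A w)) → IsODD (length D) D ⇔ WellFormed D
IsODD-length⇔WellFormed []       = mk⇔ (λ { (_ , () , _) }) (λ ())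
IsODD-length⇔WellFormed (B ∷ Bs) = mk⇔
  (λ (_ , _ , adj , flags) → proj₁ (flags zero) , from (chain⇔ B Bs) (proj₂ (flags zero) , flags ∘ suc , adj))
  (λ (i , c) → let (f , flags , adj) = to (chain⇔ B Bs) c
               in refl , s≤s z≤n , adj , λ { zero → i , f ; (suc j) → flags j })

-- A state records the right boundary and the φ-flag of the previous layer, and whether all
-- checks so far succeeded.
module OddRecognition (A : Set) (w : ℕ) where
  Stateₒ : Set
  Stateₒ = Maybe (Vec Bool w × Bool) × Bool

  adjacent? : (R : Vec Bool w) (B : Layer A w) → Dec (∀ p → ℓ B p ≡ lookup R p)
  adjacent? R B = all? λ p → ℓ B p ≟ᵇ lookup R p

  stepₒ : Stateₒ → Layer A w → Stateₒ
  stepₒ (nothing      , ok) B = just (tabulate (r B) , φ B) , ok ∧ ι B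
  stepₒ (just (R , f) , ok) B = just (tabulate (r B) , φ B) , ok ∧ (not f ∧ (not (ι B) ∧ ⌊ adjacent? R B ⌋))

  acceptingₒ : Stateₒ → Bool
  acceptingₒ (nothing     , _)  = false
  acceptingₒ (just (_ , f) , ok) = ok ∧ f

  oddAutomaton : Automaton (Layer A w)
  oddAutomaton = record
    { State = Stateₒ ; finite = finite-× (finite-Maybe (finite-× (finite-Vec finite-Bool w) finite-Bool)) finite-Bool
    ; start = nothing , true ; step = stepₒ ; accepting = acceptingₒ }

  isTrue-adjacent? : (B B′ : Layer A w) → IsTrue ⌊ adjacent? (tabulate (r B)) B′ ⌋ ⇔ (∀ p → ℓ B′ p ≡ r B p)
  isTrue-adjacent? B B′ =
    mk⇔ (λ h p → trans (h p) (lookup∘tabulate (r B) p)) (λ h p → trans (h p) (sym (lookup∘tabulate (r B) p)))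
    ⇔-∘ isTrue-⌊⌋ (adjacent? (tabulate (r B)) B′)

  run-after : ∀ B ok Bs → IsTrue (acceptingₒ (run oddAutomaton (just (tabulate (r B) , φ B) , ok) Bs)) ⇔ (IsTrue ok × Chain B Bs)
  run-after B ok [] = (⇔-id _ ×-⇔ T-≡) ⇔-∘ T-∧
  run-after B ok (B′ ∷ Bs) = mk⇔
    (λ t → let (o , c) = to ih t ; (o₁ , o₂) = to T-∧ o ; (nf , o₃) = to T-∧ o₂ ; (ni , adj) = to T-∧ o₃
           in o₁ , to T-not-≡ nf , to T-not-≡ ni , to (isTrue-adjacent? B B′) adj , c)
    (λ (o , f , i , a , c) →
       from ih (from T-∧ (o , from T-∧ (from T-not-≡ f , from T-∧ (from T-not-≡ i , from (isTrue-adjacent? B B′) a))) , c))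
    where ih = run-after B′ (ok ∧ (not (φ B) ∧ (not (ι B′) ∧ ⌊ adjacent? (tabulate (r B)) B′ ⌋))) Bs

  recognizes-oddAutomaton : Recognizes oddAutomaton (λ D → IsODD (length D) D)
  recognizes-oddAutomaton []       = mk⇔ (λ ()) (λ { (_ , () , _) })
  recognizes-oddAutomaton (B ∷ Bs) =
    ⇔-sym (IsODD-length⇔WellFormed (B ∷ Bs)) ⇔-∘ ((T-≡ ×-⇔ ⇔-id _) ⇔-∘ run-after B (true ∧ ι B) Bs)

Regular-IsODD : (A : Set) (w : ℕ) → Regular (Layer A w) (λ D → IsODD (length D) D)
Regular-IsODD A w = oddAutomaton , recognizes-oddAutomaton
  where open OddRecognition A w

-- Only read through fromMaybe on tracks consisting of just-letters, so its fields never matter.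
default-layer : {X : Set} {w : ℕ} → Layer X w
default-layer = record
  { ℓ = λ _ → false ; r = λ _ → false ; T = λ _ _ _ → false ; I = λ _ → false ; F = λ _ → false ; ι = false ; φ = false
  ; T⊆ = λ _ _ _ () ; I⊆ = λ _ () ; F⊆ = λ _ () ; ιI = λ _ _ → refl ; φF = λ _ _ → refl }

-- Tensors

private
  variable
    Γ : Set
    Γs Δs : List Set

length-tensorN : ∀ Γs k (us : StrTup Γs) → length (tensorN Γs k us) ≡ k
length-tensorN Γs zero    us = refl
length-tensorN Γs (suc k) us = cong suc (length-tensorN Γs k (tls Γs us))

tensorN-∷ : ∀ Γ Γs k (u : List Γ) us → tensorN (Γ ∷ Γs) k (u , us) ≡ zip (padTo k u) (tensorN Γs k us)
tensorN-∷ Γ Γs zero    u       us = refl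
tensorN-∷ Γ Γs (suc k) []      us = cong (_ ∷_) (tensorN-∷ Γ Γs k [] (tls Γs us))
tensorN-∷ Γ Γs (suc k) (x ∷ u) us = cong (_ ∷_) (tensorN-∷ Γ Γs k u (tls Γs us))

tensorN-∷≡⇔ : ∀ Γ Γs k (u : List Γ) us ys →
  (tensorN (Γ ∷ Γs) k (u , us) ≡ ys) ⇔ (padTo k u ≡ map proj₁ ys × tensorN Γs k us ≡ map proj₂ ys)
tensorN-∷≡⇔ Γ Γs k u us ys rewrite tensorN-∷ Γ Γs k u us =
  zip≡⇔ (padTo k u) (tensorN Γs k us) ys (trans (length-padTo k u) (sym (length-tensorN Γs k us)))

tensorN-injective : ∀ Γs k {us us′ : StrTup Γs} → maxLen Γs us ≤ k → maxLen Γs us′ ≤ k →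
                    tensorN Γs k us ≡ tensorN Γs k us′ → us ≡ us′
tensorN-injective []       k {tt}     {tt}       _  _   _ = refl
tensorN-injective (Γ ∷ Γs) k {u , us} {u′ , us′} le le′ e =
  let (pad≡ , rest≡)   = to (tensorN-∷≡⇔ Γ Γs k u us _) e
      (pad≡′ , rest≡′) = to (tensorN-∷≡⇔ Γ Γs k u′ us′ _) refl
  in cong₂ _,_ (padTo-injective k (≤-trans (m≤m⊔n _ _) le) (≤-trans (m≤m⊔n _ _) le′) (trans pad≡ (sym pad≡′)))
               (tensorN-injective Γs k (≤-trans (m≤n⊔m (length u) _) le) (≤-trans (m≤n⊔m (length u′) _) le′)
                                       (trans rest≡ (sym rest≡′)))

-- Past the end of all components, pad k (tensor us) has the letter #, while tensorN k us has a
-- column of #'s; collapse identifies the two.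
blank : ∀ Γs → SymTup Γs
blank []       = tt
blank (Γ ∷ Γs) = nothing , blank Γs

isBlank : ∀ Γs → SymTup Γs → Bool
isBlank []       tt       = true
isBlank (Γ ∷ Γs) (c , cs) = not (is-just c) ∧ isBlank Γs cs

collapse : ∀ Γs → SymTup Γs → Maybe (SymTup Γs)
collapse Γs c = if isBlank Γs c then nothing else just c

expand : ∀ Γs → Maybe (SymTup Γs) → SymTup Γs
expand Γs = fromMaybe (blank Γs)

nonBlank : ∀ Γs → Maybe (SymTup Γs) → Bool
nonBlank Γs nothing  = true
nonBlank Γs (just c) = not (isBlank Γs c)

isBlank-hds : ∀ Γs us → isBlank Γs (hds Γs us) ≡ (maxLen Γs us ≡ᵇ 0)
isBlank-hds []       tt           = refl
isBlank-hds (Γ ∷ Γs) ([] , us)    = isBlank-hds Γs us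
isBlank-hds (Γ ∷ Γs) (x ∷ u , us) with maxLen Γs us
... | zero  = refl
... | suc _ = refl

pred-suc-⊔ : ∀ a m → pred (suc a ⊔ m) ≡ a ⊔ pred m
pred-suc-⊔ a zero    = sym (⊔-identityʳ a)
pred-suc-⊔ a (suc m) = refl

maxLen-tls : ∀ Γs us → maxLen Γs (tls Γs us) ≡ pred (maxLen Γs us)
maxLen-tls []       tt           = refl
maxLen-tls (Γ ∷ Γs) ([] , us)    = maxLen-tls Γs us
maxLen-tls (Γ ∷ Γs) (x ∷ u , us) =
  trans (cong (length u ⊔_) (maxLen-tls Γs us)) (sym (pred-suc-⊔ (length u) (maxLen Γs us)))

map-collapse-tensorN-blank : ∀ Γs k us → maxLen Γs us ≡ 0 → map (collapse Γs) (tensorN Γs k us) ≡ replicate k nothing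
map-collapse-tensorN-blank Γs zero    us e = refl
map-collapse-tensorN-blank Γs (suc k) us e rewrite isBlank-hds Γs us | e =
  cong (nothing ∷_) (map-collapse-tensorN-blank Γs k (tls Γs us) (trans (maxLen-tls Γs us) (cong pred e)))

map-collapse-tensorN : ∀ Γs k us → maxLen Γs us ≤ k →
  map (collapse Γs) (tensorN Γs k us) ≡ map just (tensorN Γs (maxLen Γs us) us) ++ replicate (k ∸ maxLen Γs us) nothing
map-collapse-tensorN Γs k us le with maxLen Γs us in eq
... | zero = map-collapse-tensorN-blank Γs k us eq
map-collapse-tensorN Γs (suc k) us (s≤s le) | suc m rewrite isBlank-hds Γs us | eq =
  cong (just (hds Γs us) ∷_)
    (subst (λ j → map (collapse Γs) (tensorN Γs k (tls Γs us)) ≡ map just (tensorN Γs j (tls Γs us)) ++ replicate (k ∸ j) nothing)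
           maxLen-tail (map-collapse-tensorN Γs k (tls Γs us) (subst (_≤ k) (sym maxLen-tail) le)))
  where
  maxLen-tail : maxLen Γs (tls Γs us) ≡ m
  maxLen-tail = trans (maxLen-tls Γs us) (cong pred eq)

pad-tensor : ∀ Γs k us → maxLen Γs us ≤ k → pad k (tensor Γs us) ≡ map (collapse Γs) (tensorN Γs k us)
pad-tensor Γs k us le =
  trans (cong (λ j → map just (tensor Γs us) ++ replicate (k ∸ j) nothing) (length-tensorN Γs (maxLen Γs us) us))
        (sym (map-collapse-tensorN Γs k us le))

isBlank-blank : ∀ Γs → isBlank Γs (blank Γs) ≡ true
isBlank-blank []       = refl
isBlank-blank (Γ ∷ Γs) = isBlank-blank Γs

isBlank⇒blank : ∀ Γs c → isBlank Γs c ≡ true → c ≡ blank Γs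
isBlank⇒blank []       tt            _ = refl
isBlank⇒blank (Γ ∷ Γs) (nothing , c) e = cong (nothing ,_) (isBlank⇒blank Γs c e)

map-collapse≡⇔ : ∀ Γs ys g → (map (collapse Γs) ys ≡ g) ⇔ (ys ≡ map (expand Γs) g × All (IsTrue ∘ nonBlank Γs) g)
map-collapse≡⇔ Γs ys g = mk⇔ (sound ys g) (λ (e , ok) → complete ys g e ok)
  where
  sound : ∀ ys g → map (collapse Γs) ys ≡ g → ys ≡ map (expand Γs) g × All (IsTrue ∘ nonBlank Γs) g
  sound []       [] _ = refl , []
  sound (c ∷ ys) (m ∷ g) e with sound ys g (∷-injectiveʳ e) | ∷-injectiveˡ e
  ... | e′ , ok | e-head with isBlank Γs c in blank?
  sound (c ∷ ys) (.nothing ∷ g) e | e′ , ok | refl | true  = cong₂ _∷_ (isBlank⇒blank Γs c blank?) e′ , tt ∷ ok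
  sound (c ∷ ys) (.(just c) ∷ g) e | e′ , ok | refl | false =
    cong (c ∷_) e′ , subst (IsTrue ∘ not) (sym blank?) tt ∷ ok
  complete : ∀ ys g → ys ≡ map (expand Γs) g → All (IsTrue ∘ nonBlank Γs) g → map (collapse Γs) ys ≡ g
  complete _ []           refl []       = refl
  complete _ (nothing ∷ g) refl (_ ∷ ok) rewrite isBlank-blank Γs = cong (nothing ∷_) (complete _ g refl ok)
  complete _ (just c ∷ g)  refl (t ∷ ok) rewrite to T-not-≡ t = cong (just c ∷_) (complete _ g refl ok)

splitSym : ∀ Γs Δs → SymTup (Γs ++ Δs) → SymTup Γs × SymTup Δs
splitSym []       Δs c        = tt , c
splitSym (Γ ∷ Γs) Δs (c , cs) = map₁ (c ,_) (splitSym Γs Δs cs)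

joinSym : ∀ Γs Δs → SymTup Γs × SymTup Δs → SymTup (Γs ++ Δs)
joinSym []       Δs (tt , d)     = d
joinSym (Γ ∷ Γs) Δs ((c , cs) , d) = c , joinSym Γs Δs (cs , d)

joinSym-splitSym : ∀ Γs Δs c → joinSym Γs Δs (splitSym Γs Δs c) ≡ c
joinSym-splitSym []       Δs c        = refl
joinSym-splitSym (Γ ∷ Γs) Δs (c , cs) = cong (c ,_) (joinSym-splitSym Γs Δs cs)

joinTup : ∀ Γs Δs → StrTup Γs → StrTup Δs → StrTup (Γs ++ Δs)
joinTup []       Δs tt       vs = vs
joinTup (Γ ∷ Γs) Δs (u , us) vs = u , joinTup Γs Δs us vs

splitTup-joinTup : ∀ Γs Δs us vs → splitTup Γs Δs (joinTup Γs Δs us vs) ≡ (us , vs)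
splitTup-joinTup []       Δs tt       vs = refl
splitTup-joinTup (Γ ∷ Γs) Δs (u , us) vs rewrite splitTup-joinTup Γs Δs us vs = refl

joinTup-splitTup : ∀ Γs Δs r → joinTup Γs Δs (proj₁ (splitTup Γs Δs r)) (proj₂ (splitTup Γs Δs r)) ≡ r
joinTup-splitTup []       Δs r       = refl
joinTup-splitTup (Γ ∷ Γs) Δs (u , r) = cong (u ,_) (joinTup-splitTup Γs Δs r)

maxLen-joinTup : ∀ Γs Δs us vs → maxLen (Γs ++ Δs) (joinTup Γs Δs us vs) ≡ maxLen Γs us ⊔ maxLen Δs vs
maxLen-joinTup []       Δs tt       vs = refl
maxLen-joinTup (Γ ∷ Γs) Δs (u , us) vs = trans (cong (length u ⊔_) (maxLen-joinTup Γs Δs us vs)) (sym (⊔-assoc (length u) _ _))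

allNE-joinTup : ∀ Γs Δs us vs → AllNE Γs us → AllNE Δs vs → AllNE (Γs ++ Δs) (joinTup Γs Δs us vs)
allNE-joinTup []       Δs tt       vs _          ne = ne
allNE-joinTup (Γ ∷ Γs) Δs (u , us) vs (p , neus) ne = p , allNE-joinTup Γs Δs us vs neus ne

splitSym-hds : ∀ Γs Δs us vs → splitSym Γs Δs (hds (Γs ++ Δs) (joinTup Γs Δs us vs)) ≡ (hds Γs us , hds Δs vs)
splitSym-hds []       Δs tt           vs = refl
splitSym-hds (Γ ∷ Γs) Δs ([] , us)    vs = cong (map₁ (nothing ,_)) (splitSym-hds Γs Δs us vs)
splitSym-hds (Γ ∷ Γs) Δs (x ∷ u , us) vs = cong (map₁ (just x ,_)) (splitSym-hds Γs Δs us vs)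

tls-joinTup : ∀ Γs Δs us vs → tls (Γs ++ Δs) (joinTup Γs Δs us vs) ≡ joinTup Γs Δs (tls Γs us) (tls Δs vs)
tls-joinTup []       Δs tt           vs = refl
tls-joinTup (Γ ∷ Γs) Δs ([] , us)    vs = cong ([] ,_) (tls-joinTup Γs Δs us vs)
tls-joinTup (Γ ∷ Γs) Δs (x ∷ u , us) vs = cong (u ,_) (tls-joinTup Γs Δs us vs)

map-splitSym-tensorN : ∀ Γs Δs k us vs →
  map (splitSym Γs Δs) (tensorN (Γs ++ Δs) k (joinTup Γs Δs us vs)) ≡ zip (tensorN Γs k us) (tensorN Δs k vs)
map-splitSym-tensorN Γs Δs zero    us vs = refl
map-splitSym-tensorN Γs Δs (suc k) us vs = cong₂ _∷_ (splitSym-hds Γs Δs us vs)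
  (trans (cong (map (splitSym Γs Δs) ∘ tensorN (Γs ++ Δs) k) (tls-joinTup Γs Δs us vs))
         (map-splitSym-tensorN Γs Δs k (tls Γs us) (tls Δs vs)))

lookupSym : ∀ {n} → Tens A n → Fin n → Maybe A
lookupSym (c , _)  zero    = c
lookupSym (_ , cs) (suc i) = lookupSym cs i

select : ∀ {n a} → Vec (Fin n) a → Tens A n → Tens A a
select []       c = tt
select (x ∷ xs) c = lookupSym c x , select xs c

map-lookupSym-tensorN : ∀ n k (vs : StrTup (replicate n A)) (i : Fin n) →
  map (λ c → lookupSym c i) (tensorN (replicate n A) k vs) ≡ padTo k (lookup (tupToVec n vs) i)
map-lookupSym-tensorN {A} (suc n) k (u , vs) zero =
  sym (proj₁ (to (tensorN-∷≡⇔ A (replicate n A) k u vs _) refl))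
map-lookupSym-tensorN {A} (suc n) k (u , vs) (suc i) =
  trans (map-∘ (tensorN (replicate (suc n) A) k (u , vs)))
        (trans (cong (map (λ c → lookupSym c i)) (sym (proj₂ (to (tensorN-∷≡⇔ A (replicate n A) k u vs _) refl))))
               (map-lookupSym-tensorN n k vs i))

tensorN-select : ∀ {n a} k (vs : StrTup (replicate n A)) (xs : Vec (Fin n) a) →
  tensorN (replicate a A) k (vecToTup (Data.Vec.map (lookup (tupToVec n vs)) xs))
    ≡ map (select xs) (tensorN (replicate n A) k vs)
tensorN-select {n = n} k vs [] =
  List⊤-≡ (trans (length-tensorN [] k tt) (sym (trans (length-map _ (tensorN _ k vs)) (length-tensorN _ k vs))))
tensorN-select {A} {n} {suc a} k vs (x ∷ xs) = from (tensorN-∷≡⇔ A (replicate a A) k _ _ _)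
  ( trans (sym (map-lookupSym-tensorN n k vs x)) (map-∘ (tensorN (replicate n A) k vs))
  , trans (tensorN-select k vs xs) (map-∘ (tensorN (replicate n A) k vs)))

lookup-allRep : ∀ n {P : List A → Set} (vs : StrTup (replicate n A)) → AllRep n P vs → ∀ i → P (lookup (tupToVec n vs) i)
lookup-allRep (suc n) (u , vs) (p , _)  zero    = p
lookup-allRep (suc n) (u , vs) (_ , ps) (suc i) = lookup-allRep n vs ps i

maxLen-select≤ : ∀ {n a} k (ρ : Vec (List A) n) → (∀ i → length (lookup ρ i) ≤ k) → (xs : Vec (Fin n) a) →
                 maxLen (replicate a A) (vecToTup (Data.Vec.map (lookup ρ) xs)) ≤ k
maxLen-select≤ k ρ bound []       = z≤n
maxLen-select≤ k ρ bound (x ∷ xs) = ⊔-lub (bound x) (maxLen-select≤ k ρ bound xs)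

maxLen-select-positive : ∀ {n a} (ρ : Vec (List A) n) → (∀ i → 0 < length (lookup ρ i)) → (xs : Vec (Fin n) a) →
                         (0 < maxLen (replicate a A) (vecToTup (Data.Vec.map (lookup ρ) xs))) ⇔ (0 < a)
maxLen-select-positive ρ positive []       = mk⇔ (λ ()) (λ ())
maxLen-select-positive ρ positive (x ∷ xs) = mk⇔ (λ _ → s≤s z≤n) (λ _ → ≤-trans (positive x) (m≤m⊔n _ _))

Track : {C Γ : Set} → (List C → List Γ → Set) → List (C × Maybe Γ) → Set
Track P zz = ∃ λ u → P (map proj₁ zz) u × padTo (length zz) u ≡ map proj₂ zz

TensorTrack : {C : Set} (Γs : List Set) → (List C → StrTup Γs → Set) → List (C × SymTup Γs) → Set
TensorTrack Γs Q zz = ∃ λ us → Q (map proj₁ zz) us × tensorN Γs (length zz) us ≡ map proj₂ zz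

module _ {C : Set} where
  firstTrack : C × SymTup (Γ ∷ Γs) → C × Maybe Γ
  firstTrack p = proj₁ p , proj₁ (proj₂ p)

  otherTracks : C × SymTup (Γ ∷ Γs) → C × SymTup Γs
  otherTracks p = proj₁ p , proj₂ (proj₂ p)

  Regular-TensorTrack-[] : {Q : List C → ⊤ → Set} → (∀ cs → Q cs tt) → Regular (C × ⊤) (TensorTrack [] Q)
  Regular-TensorTrack-[] q = Regular-resp
    (λ zz → mk⇔ (λ _ → tt , q _ , List⊤-≡ (trans (length-tensorN [] (length zz) tt) (sym (length-map proj₂ zz)))) _)
    (Regular-const (yes tt))

  Regular-TensorTrack-∷ : {P : List C → List Γ → Set} {Q : List C → StrTup Γs → Set} {R : List C → StrTup (Γ ∷ Γs) → Set} →
    (∀ cs u us → R cs (u , us) ⇔ (P cs u × Q cs us)) →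
    Regular (C × Maybe Γ) (Track P) → Regular (C × SymTup Γs) (TensorTrack Γs Q) →
    Regular (C × SymTup (Γ ∷ Γs)) (TensorTrack (Γ ∷ Γs) R)
  Regular-TensorTrack-∷ {Γ = Γ} {Γs = Γs} {P = P} {Q = Q} {R = R} R⇔ first others =
    Regular-resp (λ zz → mk⇔ (sound zz) (complete zz))
      (Regular-× (Regular-comap firstTrack first) (Regular-comap otherTracks others))
    where
    module _ (zz : List (C × SymTup (Γ ∷ Γs))) where
      |first| : length (map firstTrack zz) ≡ length zz
      |first| = length-map firstTrack zz
      |others| : length (map otherTracks zz) ≡ length zz
      |others| = length-map otherTracks zz
      heads : map proj₂ (map firstTrack zz) ≡ map proj₁ (map proj₂ zz)
      heads = trans (sym (map-∘ zz)) (map-∘ zz)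
      tails : map proj₂ (map otherTracks zz) ≡ map proj₂ (map proj₂ zz)
      tails = trans (sym (map-∘ zz)) (map-∘ zz)
    sound : ∀ zz → Track P (map firstTrack zz) × TensorTrack Γs Q (map otherTracks zz) → TensorTrack (Γ ∷ Γs) R zz
    sound zz ((u , p , pad≡) , (us , q , tensor≡)) =
      (u , us) ,
      from (R⇔ _ u us) (subst (λ cs → P cs u) (sym (map-∘ zz)) p , subst (λ cs → Q cs us) (sym (map-∘ zz)) q) ,
      from (tensorN-∷≡⇔ Γ Γs (length zz) u us (map proj₂ zz))
        ( trans (cong (λ k → padTo k u) (sym (|first| zz))) (trans pad≡ (heads zz))
        , trans (cong (λ k → tensorN Γs k us) (sym (|others| zz))) (trans tensor≡ (tails zz)))
    complete : ∀ zz → TensorTrack (Γ ∷ Γs) R zz → Track P (map firstTrack zz) × TensorTrack Γs Q (map otherTracks zz)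
    complete zz ((u , us) , r , tensor≡) =
      let (pad≡ , tensor≡′) = to (tensorN-∷≡⇔ Γ Γs (length zz) u us (map proj₂ zz)) tensor≡
          (p , q) = to (R⇔ _ u us) r in
      (u , subst (λ cs → P cs u) (map-∘ zz) p , trans (cong (λ k → padTo k u) (|first| zz)) (trans pad≡ (sym (heads zz)))) ,
      (us , subst (λ cs → Q cs us) (map-∘ zz) q ,
            trans (cong (λ k → tensorN Γs k us) (|others| zz)) (trans tensor≡′ (sym (tails zz))))

module TensorPowers (X : Set) (w : ℕ) where
  L₀ : Set
  L₀ = Layer X w

  AcceptedTrack : List (L₀ × Maybe X) → Set
  AcceptedTrack = Track AcceptsODD

  Regular-AcceptedTrack : Regular (L₀ × Maybe X) AcceptedTrack
  Regular-AcceptedTrack =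
    Regular-resp (λ zz → mk⇔ (sound zz) (complete zz))
      (Regular-× (Regular-comap proj₂ Regular-IsPadded) (Regular-AcceptingPath X w))
    where
    |zz| : ∀ zz → length (map proj₂ zz) ≡ length (map proj₁ zz)
    |zz| zz = trans (length-map proj₂ zz) (sym (length-map proj₁ zz))
    sound : ∀ zz → IsPadded (map proj₂ zz) × AcceptingPath (map proj₁ zz) (map proj₂ zz) → AcceptedTrack zz
    sound zz (padded , path) =
      unpad (map proj₂ zz) , from (accepts⇔path _ _ padded (|zz| zz)) path ,
      subst (λ k → padTo k (unpad (map proj₂ zz)) ≡ map proj₂ zz) (length-map proj₂ zz) (padTo-unpad _ padded)
    complete : ∀ zz → AcceptedTrack zz → IsPadded (map proj₂ zz) × AcceptingPath (map proj₁ zz) (map proj₂ zz)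
    complete zz (u , acc , e) =
      subst IsPadded e (isPadded-padTo _ u (proj₁ acc) |u|≤|zz|) ,
      subst (AcceptingPath (map proj₁ zz)) (trans (cong (λ k → padTo k u) (length-map proj₁ zz)) e) (accepts⇒path _ u acc)
      where
      |u|≤|zz| : length u ≤ length zz
      |u|≤|zz| = subst (length u ≤_) (length-map proj₁ zz) (proj₁ (proj₂ acc))

  Components : ∀ a → List (L₀ × Tens X a) → Set
  Components a = TensorTrack (replicate a X) (λ D → AllRep a (AcceptsODD D))

  Regular-Components : ∀ a → Regular (L₀ × Tens X a) (Components a)
  Regular-Components zero    = Regular-TensorTrack-[] (λ _ → tt)
  Regular-Components (suc a) =
    Regular-TensorTrack-∷ {P = AcceptsODD} {Q = λ D → AllRep a (AcceptsODD D)} (λ _ _ _ → ⇔-id _)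
                          Regular-AcceptedTrack (Regular-Components a)

  maxLen-accepted : ∀ a (D : List L₀) us → AllRep a (AcceptsODD D) us → maxLen (replicate a X) us ≤ length D
  maxLen-accepted zero    D tt       _            = z≤n
  maxLen-accepted (suc a) D (u , us) (acc , accs) = ⊔-lub (proj₁ (proj₂ acc)) (maxLen-accepted a D us accs)

  allNE-accepted : ∀ a {D : List L₀} us → AllRep a (AcceptsODD D) us → AllNE (replicate a X) us
  allNE-accepted zero    tt       _            = tt
  allNE-accepted (suc a) (u , us) (acc , accs) = proj₁ acc , allNE-accepted a us accs

  InPowTrack : ∀ a → List (L₀ × Maybe (Tens X a)) → Set
  InPowTrack a zz = IsPadded (map proj₂ zz) × InPow (AcceptsODD (map proj₁ zz)) a (unpad (map proj₂ zz))

  expandTrack : ∀ {a} → L₀ × Maybe (Tens X a) → L₀ × Tens X a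
  expandTrack {a} p = proj₁ p , expand (replicate a X) (proj₂ p)

  Regular-InPowTrack : ∀ a → Regular (L₀ × Maybe (Tens X a)) (InPowTrack a)
  Regular-InPowTrack a = Regular-resp (λ zz → mk⇔ (sound zz) (complete zz))
    (Regular-× (Regular-comap proj₂ Regular-IsPadded)
    (Regular-× (Regular-comap proj₂ (Regular-All (T? ∘ nonBlank Xs))) (Regular-comap expandTrack (Regular-Components a))))
    where
    Xs = replicate a X
    module _ (zz : List (L₀ × Maybe (Tens X a))) where
      k = length zz
      g = map proj₂ zz
      expanded : map proj₂ (map expandTrack zz) ≡ map (expand Xs) g
      expanded = trans (sym (map-∘ zz)) (map-∘ zz)
      |expanded| : length (map expandTrack zz) ≡ k
      |expanded| = length-map expandTrack zz
      maxLen≤k : ∀ us → AllRep a (AcceptsODD (map proj₁ zz)) us → maxLen Xs us ≤ k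
      maxLen≤k us accs = subst (maxLen Xs us ≤_) (length-map proj₁ zz) (maxLen-accepted a _ us accs)
      pad-unpad : IsPadded g → pad k (unpad g) ≡ g
      pad-unpad padded = trans (sym (padTo≡pad k (unpad g) |unpad|≤k))
                               (subst (λ j → padTo j (unpad g) ≡ g) (length-map proj₂ zz) (padTo-unpad g padded))
        where
        |unpad|≤k : length (unpad g) ≤ k
        |unpad|≤k = subst (length (unpad g) ≤_) (length-map proj₂ zz) (proj₂ (unpad-bounds g padded))
    sound : ∀ zz → IsPadded (map proj₂ zz) × All (IsTrue ∘ nonBlank Xs) (map proj₂ zz) × Components a (map expandTrack zz) →
            InPowTrack a zz
    sound zz (padded , nonblank , us , accs , tensor≡) = padded , us , allNE-accepted a us accs′ , accs′ , tensor≡unpad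
      where
      accs′ : AllRep a (AcceptsODD (map proj₁ zz)) us
      accs′ = subst (λ D → AllRep a (AcceptsODD D) us) (sym (map-∘ zz)) accs
      ml = maxLen≤k zz us accs′
      tensorN≡ : tensorN Xs (length zz) us ≡ map (expand Xs) (map proj₂ zz)
      tensorN≡ = trans (cong (λ j → tensorN Xs j us) (sym (|expanded| zz))) (trans tensor≡ (expanded zz))
      tensor≡unpad : tensor Xs us ≡ unpad (map proj₂ zz)
      tensor≡unpad = trans (sym (unpad-pad (length zz) (tensor Xs us) (subst (_≤ length zz) (sym (length-tensorN Xs _ us)) ml)))
        (cong unpad (trans (pad-tensor Xs (length zz) us ml) (from (map-collapse≡⇔ Xs _ _) (tensorN≡ , nonblank))))
    complete : ∀ zz → InPowTrack a zz →
               IsPadded (map proj₂ zz) × All (IsTrue ∘ nonBlank Xs) (map proj₂ zz) × Components a (map expandTrack zz)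
    complete zz (padded , us , _ , accs , tensor≡) =
      padded , proj₂ expanded≡ , us , subst (λ D → AllRep a (AcceptsODD D) us) (map-∘ zz) accs ,
      trans (cong (λ j → tensorN Xs j us) (|expanded| zz)) (trans (proj₁ expanded≡) (sym (expanded zz)))
      where
      expanded≡ = to (map-collapse≡⇔ Xs (tensorN Xs (length zz) us) (map proj₂ zz))
        (trans (sym (pad-tensor Xs (length zz) us (maxLen≤k zz us accs)))
               (trans (cong (pad (length zz)) tensor≡) (pad-unpad zz padded)))

  module _ (a : ℕ) where
    Lᵃ : Set
    Lᵃ = Layer (Tens X a) w

    Structural : List (L₀ × Lᵃ) → Set
    Structural zz = ∀ x → AcceptsODD (map proj₂ zz) x → InPow (AcceptsODD (map proj₁ zz)) a x

    Violation : List ((L₀ × Lᵃ) × Maybe (Tens X a)) → Set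
    Violation zz = IsPadded (map proj₂ zz)
                 × AcceptingPath (map proj₁ (map (map₁ proj₂) zz)) (map proj₂ (map (map₁ proj₂) zz))
                 × ¬ InPowTrack a (map (map₁ proj₁) zz)

    Regular-Violation : Regular ((L₀ × Lᵃ) × Maybe (Tens X a)) Violation
    Regular-Violation =
      Regular-× (Regular-comap proj₂ Regular-IsPadded)
      (Regular-× (Regular-comap (map₁ proj₂) (Regular-AcceptingPath (Tens X a) w))
                 (Regular-¬ (Regular-comap (map₁ proj₁) (Regular-InPowTrack a))))

    module _ (zz : List (L₀ × Lᵃ)) (g : List (Maybe (Tens X a))) (|g| : length g ≡ length zz) where
      |zz|≡|g| : ∀ (f : L₀ × Lᵃ → B) → length (map f zz) ≡ length g
      |zz|≡|g| f = trans (length-map f zz) (sym |g|)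

      inPowTrack-zip⇔ : InPowTrack a (map (map₁ proj₁) (zip zz g)) ⇔ (IsPadded g × InPow (AcceptsODD (map proj₁ zz)) a (unpad g))
      inPowTrack-zip⇔ rewrite map-map₁-zip proj₁ zz g | map-proj₁-zip (map proj₁ zz) g (|zz|≡|g| proj₁)
                            | map-proj₂-zip (map proj₁ zz) g (|zz|≡|g| proj₁) = ⇔-id _

      violation-zip⇔ : Violation (zip zz g) ⇔
        (IsPadded g × AcceptingPath (map proj₂ zz) g × ¬ (IsPadded g × InPow (AcceptsODD (map proj₁ zz)) a (unpad g)))
      violation-zip⇔ rewrite map-proj₂-zip zz g (sym |g|) | map-map₁-zip proj₂ zz g
                           | map-proj₁-zip (map proj₂ zz) g (|zz|≡|g| proj₂) | map-proj₂-zip (map proj₂ zz) g (|zz|≡|g| proj₂) =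
        ⇔-id _ ×-⇔ (⇔-id _ ×-⇔ mk⇔ (_∘ from inPowTrack-zip⇔) (_∘ to inPowTrack-zip⇔))

    -- The inclusion fails iff some padded word is accepted by the Dᵢ track and not in L(D₀)^{⊗a}.
    Regular-Structural : Finite X → Regular (L₀ × Lᵃ) Structural
    Regular-Structural finX = Regular-resp (λ zz → mk⇔ (sound zz) (complete zz))
      (Regular-¬ (Regular-∃ (finite-Maybe (finite-SymTup finX a)) Regular-Violation))
      where
      sound : ∀ zz → ¬ (∃ λ g → length g ≡ length zz × Violation (zip zz g)) → Structural zz
      sound zz noViolation x acc = decide (Regular-dec (Regular-InPowTrack a) (map (map₁ proj₁) (zip zz g)))
        where
        g = padTo (length zz) x
        |g| = length-padTo (length zz) x
        |x|≤|zz| = subst (length x ≤_) (length-map proj₂ zz) (proj₁ (proj₂ acc))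
        decide : Dec (InPowTrack a (map (map₁ proj₁) (zip zz g))) → InPow (AcceptsODD (map proj₁ zz)) a x
        decide (yes inPow) = subst (InPow (AcceptsODD (map proj₁ zz)) a) (unpad-padTo (length zz) x |x|≤|zz|)
                                   (proj₂ (to (inPowTrack-zip⇔ zz g |g|) inPow))
        decide (no ¬inPow) = ⊥-elim (noViolation
          (g , |g| , from (violation-zip⇔ zz g |g|) (padded , path , ¬inPow ∘ from (inPowTrack-zip⇔ zz g |g|))))
          where
          padded = isPadded-padTo (length zz) x (proj₁ acc) |x|≤|zz|
          path = subst (λ k → AcceptingPath (map proj₂ zz) (padTo k x)) (length-map proj₂ zz) (accepts⇒path _ x acc)
      complete : ∀ zz → Structural zz → ¬ (∃ λ g → length g ≡ length zz × Violation (zip zz g))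
      complete zz structural (g , |g| , violation) =
        let (padded , path , ¬inPow) = to (violation-zip⇔ zz g |g|) violation
            |g|≡|D| = trans |g| (sym (length-map proj₂ zz))
        in ¬inPow (padded , structural (unpad g) (from (accepts⇔path _ g padded |g|≡|D|) path))

module StructuralTuples (s w : ℕ) where
  open TensorPowers (Fin s) w

  getSym : ∀ τ → SymTup (LayersT s w τ) → (i : Fin (length τ)) → Maybe (LayerT s w (Data.List.lookup τ i))
  getSym (a ∷ τ) (c , _)  zero    = c
  getSym (a ∷ τ) (_ , cs) (suc i) = getSym τ cs i

  map-getSym-tensorN : ∀ τ k (Ds : StrTup (LayersT s w τ)) (i : Fin (length τ)) →
    map (λ c → getSym τ c i) (tensorN (LayersT s w τ) k Ds) ≡ padTo k (getD s w τ Ds i)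
  map-getSym-tensorN (a ∷ τ) k (D , Ds) zero =
    sym (proj₁ (to (tensorN-∷≡⇔ (LayerT s w a) (LayersT s w τ) k D Ds _) refl))
  map-getSym-tensorN (a ∷ τ) k (D , Ds) (suc i) =
    trans (map-∘ (tensorN (LayersT s w (a ∷ τ)) k (D , Ds)))
          (trans (cong (map (λ c → getSym τ c i)) (sym (proj₂ (to (tensorN-∷≡⇔ (LayerT s w a) (LayersT s w τ) k D Ds _) refl))))
                 (map-getSym-tensorN τ k Ds i))

  allStructural-IsODD : ∀ τ k D₀ Ds → AllStructural s w τ k D₀ Ds → ∀ i → IsODD k (getD s w τ Ds i)
  allStructural-IsODD (a ∷ τ) k D₀ (D , Ds) (odd , _ , _)    zero    = odd
  allStructural-IsODD (a ∷ τ) k D₀ (D , Ds) (_ , _ , rest) (suc i) = allStructural-IsODD τ k D₀ Ds rest i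

  maxLen-structural : ∀ τ k D₀ Ds → AllStructural s w τ k D₀ Ds → maxLen (LayersT s w τ) Ds ≤ k
  maxLen-structural []       k D₀ tt       _                 = z≤n
  maxLen-structural (a ∷ τ) k D₀ (D , Ds) (odd , _ , rest) =
    ⊔-lub (≤-reflexive (proj₁ odd)) (maxLen-structural τ k D₀ Ds rest)

  allNE-structural : ∀ τ k D₀ Ds → AllStructural s w τ k D₀ Ds → AllNE (LayersT s w τ) Ds
  allNE-structural []       k D₀ tt       _                = tt
  allNE-structural (a ∷ τ) k D₀ (D , Ds) (odd , _ , rest) =
    subst (0 <_) (sym (proj₁ odd)) (proj₁ (proj₂ odd)) , allNE-structural τ k D₀ Ds rest

  LayerCondition : ∀ a → List L₀ → List (Lᵃ a) → Set
  LayerCondition a D₀ D = IsODD (length D₀) D × (∀ x → AcceptsODD D x → InPow (AcceptsODD D₀) a x)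

  Regular-LayerTrack : ∀ a → Regular (L₀ × Maybe (Lᵃ a)) (Track (LayerCondition a))
  Regular-LayerTrack a = Regular-resp (λ zz → mk⇔ (sound zz) (complete zz))
    (Regular-× (Regular-comap proj₂ (Regular-All (T? ∘ is-just)))
    (Regular-× (Regular-comap (fromMaybe default-layer ∘ proj₂) (Regular-IsODD (Tens (Fin s) a) w))
               (Regular-comap (map₂ (fromMaybe default-layer)) (Regular-Structural a (finite-Fin s)))))
    where
    Conditions : List (L₀ × Maybe (Lᵃ a)) → Set
    Conditions zz = AllJust (map proj₂ zz)
                  × IsODD (length (map (fromMaybe default-layer ∘ proj₂) zz)) (map (fromMaybe default-layer ∘ proj₂) zz)
                  × Structural a (map (map₂ (fromMaybe default-layer)) zz)
    module _ (zz : List (L₀ × Maybe (Lᵃ a))) where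
      h = map proj₂ zz
      |D₀| : length (map (fromMaybe default-layer ∘ proj₂) zz) ≡ length (map proj₁ zz)
      |D₀| = trans (length-map _ zz) (sym (length-map proj₁ zz))
    sound : ∀ zz → Conditions zz → Track (LayerCondition a) zz
    sound zz (allJust , odd , structural) =
      unpad (h zz) ,
      (subst₂ IsODD (|D₀| zz) D≡ odd ,
       λ x acc → subst (λ D₀ → InPow (AcceptsODD D₀) a x) (sym (map-∘ zz))
                        (structural x (subst (λ D → AcceptsODD D x) (trans (sym D≡) (map-∘ zz)) acc))) ,
      trans (cong (λ k → padTo k (unpad (h zz))) (trans (sym (length-map proj₂ zz)) (sym (length-unpad (h zz) allJust))))
            (trans (padTo-length (unpad (h zz))) (map-just-unpad (h zz) allJust))
      where
      D≡ : map (fromMaybe default-layer ∘ proj₂) zz ≡ unpad (h zz)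
      D≡ = trans (map-∘ zz) (map-fromMaybe default-layer (h zz) allJust)
    complete : ∀ zz → Track (LayerCondition a) zz → Conditions zz
    complete zz (D , (odd , structural) , pad≡) =
      subst AllJust just≡ (allJust-map-just D) ,
      subst₂ IsODD (sym (|D₀| zz)) (sym D≡) odd ,
      λ x acc → subst (λ D₀ → InPow (AcceptsODD D₀) a x) (map-∘ zz)
                       (structural x (subst (λ D → AcceptsODD D x) (trans (sym (map-∘ zz)) D≡) acc))
      where
      just≡ : map just D ≡ h zz
      just≡ = trans (sym (padTo-length D)) (trans (cong (λ k → padTo k D) (trans (proj₁ odd) (length-map proj₁ zz))) pad≡)
      D≡ : map (fromMaybe default-layer ∘ proj₂) zz ≡ D
      D≡ = trans (map-∘ zz) (trans (cong (map (fromMaybe default-layer)) (sym just≡))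
                 (trans (map-fromMaybe default-layer _ (allJust-map-just D)) (unpad-map-just D)))

  StructuralTuple : ∀ τ → List (L₀ × SymTup (LayersT s w τ)) → Set
  StructuralTuple τ = TensorTrack (LayersT s w τ) (λ D₀ → AllStructural s w τ (length D₀) D₀)

  Regular-StructuralTuple : ∀ τ → Regular (L₀ × SymTup (LayersT s w τ)) (StructuralTuple τ)
  Regular-StructuralTuple []      = Regular-TensorTrack-[] (λ _ → tt)
  Regular-StructuralTuple (a ∷ τ) =
    Regular-TensorTrack-∷ {P = LayerCondition a} {Q = λ D₀ → AllStructural s w τ (length D₀) D₀}
      (λ _ _ _ → mk⇔ (λ (odd , str , rest) → (odd , str) , rest) (λ ((odd , str) , rest) → odd , str , rest))
      (Regular-LayerTrack a) (Regular-StructuralTuple τ)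

-- Encoding structures with assignments as words

module ColumnEncoding (s w : ℕ) (τ : Vocab) where
  open TensorPowers (Fin s) w
  open StructuralTuples s w

  LTs : List Set
  LTs = LayersT s w τ

  Vs : ℕ → List Set
  Vs n = replicate n (Fin s)

  Column : ℕ → Set
  Column n = Maybe L₀ × SymTup LTs × SymTup (Vs n)

  Tuple : ℕ → Set
  Tuple n = List L₀ × StrTup LTs × StrTup (Vs n)

  Valid : ∀ {n} → Tuple n → Set
  Valid {n} (D₀ , Ds , vs) = IsODD (length D₀) D₀ × AllStructural s w τ (length D₀) D₀ Ds × AllRep n (AcceptsODD D₀) vs

  Satisfies : ∀ {n} → Tuple n → Formula τ n → Set
  Satisfies {n} (D₀ , Ds , vs) φ = Sat (derived s w τ D₀ Ds) φ (tupToVec n vs)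

  columns : ∀ {n} → Tuple n → List (Column n)
  columns {n} (D₀ , Ds , vs) = zip (map just D₀) (zip (tensorN LTs (length D₀) Ds) (tensorN (Vs n) (length D₀) vs))

  Encodes : ∀ {n} → List (Column n) → Set
  Encodes y = ∃ λ W → Valid W × columns W ≡ y

  columns≡⇔ : ∀ {n} D₀ Ds vs (y : List (Column n)) → (columns (D₀ , Ds , vs) ≡ y) ⇔
    ( map just D₀ ≡ map proj₁ y
    × tensorN LTs (length D₀) Ds ≡ map proj₁ (map proj₂ y)
    × tensorN (Vs n) (length D₀) vs ≡ map proj₂ (map proj₂ y))
  columns≡⇔ {n} D₀ Ds vs y =
    (⇔-id _ ×-⇔ zip≡⇔ (tensorN LTs k Ds) (tensorN (Vs n) k vs) (map proj₂ y) (trans |Ds| (sym |vs|)))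
    ⇔-∘ zip≡⇔ (map just D₀) _ y
          (trans (length-map just D₀) (sym (trans (length-zip (tensorN LTs k Ds) (tensorN (Vs n) k vs) (trans |Ds| (sym |vs|))) |Ds|)))
    where
    k = length D₀
    |Ds| = length-tensorN LTs k Ds
    |vs| = length-tensorN (Vs n) k vs

  columns-injective : ∀ {n} (W W′ : Tuple n) → Valid W → Valid W′ → columns W ≡ columns W′ → W ≡ W′
  columns-injective {n} (D₀ , Ds , vs) (D₀′ , Ds′ , vs′) (_ , str , acc) (_ , str′ , acc′) e
    with to (columns≡⇔ D₀ Ds vs _) e | to (columns≡⇔ D₀′ Ds′ vs′ _) refl
  ... | j≡ , t≡ , v≡ | j≡′ , t≡′ , v≡′ with map-injective just-injective (trans j≡ (sym j≡′))
  ... | refl = cong₂ _,_ refl (cong₂ _,_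
    (tensorN-injective LTs (length D₀) (maxLen-structural τ _ D₀ Ds str) (maxLen-structural τ _ D₀ Ds′ str′) (trans t≡ (sym t≡′)))
    (tensorN-injective (Vs n) (length D₀) (maxLen-accepted n D₀ vs acc) (maxLen-accepted n D₀ vs′ acc′) (trans v≡ (sym v≡′))))

  layersLetter : ∀ {n} → Column n → L₀ × SymTup LTs
  layersLetter c = fromMaybe default-layer (proj₁ c) , proj₁ (proj₂ c)

  verticesLetter : ∀ {n} → Column n → L₀ × SymTup (Vs n)
  verticesLetter c = fromMaybe default-layer (proj₁ c) , proj₂ (proj₂ c)

  module _ {n : ℕ} (y : List (Column n)) where
    private
      D : List L₀
      D = map (fromMaybe default-layer ∘ proj₁) y
      |D| : length D ≡ length y
      |D| = length-map _ y
      |layers| : length (map layersLetter y) ≡ length y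
      |layers| = length-map layersLetter y
      |vertices| : length (map verticesLetter y) ≡ length y
      |vertices| = length-map verticesLetter y
      layer-tracks : map proj₂ (map layersLetter y) ≡ map proj₁ (map proj₂ y)
      layer-tracks = trans (sym (map-∘ y)) (map-∘ y)
      vertex-tracks : map proj₂ (map verticesLetter y) ≡ map proj₂ (map proj₂ y)
      vertex-tracks = trans (sym (map-∘ y)) (map-∘ y)

    EncodingConditions : Set
    EncodingConditions = AllJust (map proj₁ y) × IsODD (length D) D
                       × StructuralTuple τ (map layersLetter y) × Components n (map verticesLetter y)

    conditions⇒encodes : EncodingConditions → Encodes y
    conditions⇒encodes (allJust , odd , (Ds , str , layers≡) , (vs , acc , vertices≡)) =
      (D , Ds , vs) ,
      (odd , subst (λ D → AllStructural s w τ (length D) D Ds) (sym (map-∘ y)) str ,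
             subst (λ D → AllRep n (AcceptsODD D) vs) (sym (map-∘ y)) acc) ,
      from (columns≡⇔ D Ds vs y)
        ( trans (cong (map just) (trans (map-∘ y) (map-fromMaybe default-layer _ allJust))) (map-just-unpad _ allJust)
        , trans (cong (λ k → tensorN LTs k Ds) (trans |D| (sym |layers|))) (trans layers≡ layer-tracks)
        , trans (cong (λ k → tensorN (Vs n) k vs) (trans |D| (sym |vertices|))) (trans vertices≡ vertex-tracks))

    encodes⇒conditions : Encodes y → EncodingConditions
    encodes⇒conditions ((D₀ , Ds , vs) , (odd , str , acc) , columns≡) =
      subst AllJust just≡ (allJust-map-just D₀) ,
      subst (λ D → IsODD (length D) D) (sym D≡D₀) odd ,
      (Ds , subst (λ D → AllStructural s w τ (length D) D Ds) (sym (trans (sym (map-∘ y)) D≡D₀)) str ,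
            trans (cong (λ k → tensorN LTs k Ds) (trans |layers| |y|≡|D₀|)) (trans layers≡ (sym layer-tracks))) ,
      (vs , subst (λ D → AllRep n (AcceptsODD D) vs) (sym (trans (sym (map-∘ y)) D≡D₀)) acc ,
            trans (cong (λ k → tensorN (Vs n) k vs) (trans |vertices| |y|≡|D₀|)) (trans vertices≡ (sym vertex-tracks)))
      where
      parts = to (columns≡⇔ D₀ Ds vs y) columns≡
      just≡ = proj₁ parts
      layers≡ = proj₁ (proj₂ parts)
      vertices≡ = proj₂ (proj₂ parts)
      D≡D₀ : D ≡ D₀
      D≡D₀ = trans (map-∘ y) (trans (cong (map (fromMaybe default-layer)) (sym just≡)) (trans (sym (map-∘ D₀)) (map-id D₀)))
      |y|≡|D₀| : length y ≡ length D₀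
      |y|≡|D₀| = trans (sym |D|) (cong length D≡D₀)

  Regular-Encodes : ∀ n → Regular (Column n) Encodes
  Regular-Encodes n = Regular-resp (λ y → mk⇔ (conditions⇒encodes y) (encodes⇒conditions y))
    (Regular-× (Regular-comap proj₁ (Regular-All (T? ∘ is-just)))
    (Regular-× (Regular-comap (fromMaybe default-layer ∘ proj₁) (Regular-IsODD (Fin s) w))
    (Regular-× (Regular-comap layersLetter (Regular-StructuralTuple τ)) (Regular-comap verticesLetter (Regular-Components n)))))

  length-columns : ∀ {n} (W : Tuple n) → length (columns W) ≡ length (proj₁ W)
  length-columns (D₀ , Ds , vs) =
    trans (sym (length-map proj₁ (columns (D₀ , Ds , vs))))
          (trans (cong length (sym (proj₁ (to (columns≡⇔ D₀ Ds vs _) refl)))) (length-map just D₀))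

  extend : ∀ {n} → Column n × Maybe (Fin s) → Column (suc n)
  extend ((c₀ , c₁ , c₂) , σ) = c₀ , c₁ , (σ , c₂)

  shrink : ∀ {n} → Column (suc n) → Column n × Maybe (Fin s)
  shrink (c₀ , c₁ , (σ , c₂)) = (c₀ , c₁ , c₂) , σ

  map-extend-zip-injective : ∀ {n} {y y′ : List (Column n)} {g g′ : List (Maybe (Fin s))} →
    length y ≡ length g → length y′ ≡ length g′ → map extend (zip y g) ≡ map extend (zip y′ g′) → y ≡ y′ × g ≡ g′
  map-extend-zip-injective {y = y} {y′} {g} {g′} |y| |y′| e =
    let (y≡ , g≡) = to (zip≡⇔ y g (zip y′ g′) |y|) (map-injective (cong shrink) e)
    in trans y≡ (map-proj₁-zip y′ g′ |y′|) , trans g≡ (map-proj₂-zip y′ g′ |y′|)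

  zip-extend : ∀ {n} (as : List (Maybe L₀)) (bs : List (SymTup LTs)) (cs : List (SymTup (Vs n))) (ds : List (Maybe (Fin s))) →
    zip as (zip bs (zip ds cs)) ≡ map extend (zip (zip as (zip bs cs)) ds)
  zip-extend []       bs       cs       ds       = refl
  zip-extend (a ∷ as) []       cs       ds       = refl
  zip-extend (a ∷ as) (b ∷ bs) []       []       = refl
  zip-extend (a ∷ as) (b ∷ bs) []       (d ∷ ds) = refl
  zip-extend (a ∷ as) (b ∷ bs) (c ∷ cs) []       = refl
  zip-extend (a ∷ as) (b ∷ bs) (c ∷ cs) (d ∷ ds) = cong (_ ∷_) (zip-extend as bs cs ds)

  columns-∷ : ∀ {n} D₀ Ds u (vs : StrTup (Vs n)) →
              columns (D₀ , Ds , (u , vs)) ≡ map extend (zip (columns (D₀ , Ds , vs)) (padTo (length D₀) u))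
  columns-∷ {n} D₀ Ds u vs =
    trans (cong (λ t → zip (map just D₀) (zip (tensorN LTs (length D₀) Ds) t)) (tensorN-∷ (Fin s) (Vs n) (length D₀) u vs))
          (zip-extend (map just D₀) _ _ _)

  Satisfying : ∀ n → Formula τ n → List (Column n) → Set
  Satisfying n φ y = ∃ λ W → Valid W × columns W ≡ y × Satisfies W φ

  RegularSat : ∀ n → Formula τ n → Set₁
  RegularSat n φ = Regular (Column n) (Satisfying n φ)

  Satisfying-unique : ∀ {n φ y} (W : Tuple n) → Valid W → columns W ≡ y → Satisfying n φ y → Satisfies W φ
  Satisfying-unique {φ = φ} W valid columns≡ (W′ , valid′ , columns≡′ , sat) =
    subst (λ W → Satisfies W φ) (columns-injective W′ W valid′ valid (trans columns≡′ (sym columns≡))) sat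

  Satisfying-cong : ∀ {n} {φ φ′ : Formula τ n} → (∀ W → Valid W → Satisfies W φ ⇔ Satisfies W φ′) →
                    ∀ y → Satisfying n φ y ⇔ Satisfying n φ′ y
  Satisfying-cong sat⇔ y = mk⇔ (λ (W , valid , c , sat) → W , valid , c , to (sat⇔ W valid) sat)
                                (λ (W , valid , c , sat) → W , valid , c , from (sat⇔ W valid) sat)

  Satisfies-dec : ∀ {n φ} → RegularSat n φ → (W : Tuple n) → Valid W → Dec (Satisfies W φ)
  Satisfies-dec {φ = φ} R W valid = Decidable.map
    (mk⇔ (Satisfying-unique {φ = φ} W valid refl) (λ sat → W , valid , refl , sat)) (Regular-dec R (columns W))

  Regular-Satisfying-neg : ∀ {n φ} → RegularSat n φ → RegularSat n (neg φ)
  Regular-Satisfying-neg {φ = φ} R = Regular-resp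
    (λ y → mk⇔ (λ ((W , valid , c) , ¬L) → W , valid , c , λ sat → ¬L (W , valid , c , sat))
               (λ (W , valid , c , ¬sat) → (W , valid , c) , ¬sat ∘ Satisfying-unique {φ = φ} W valid c))
    (Regular-× (Regular-Encodes _) (Regular-¬ R))

  Regular-Satisfying-conj : ∀ {n φ χ} → RegularSat n φ → RegularSat n χ → RegularSat n (conj φ χ)
  Regular-Satisfying-conj {χ = χ} R₁ R₂ = Regular-resp
    (λ y → mk⇔ (λ ((W , valid , c , sat) , L) → W , valid , c , sat , Satisfying-unique {φ = χ} W valid c L)
               (λ (W , valid , c , sat₁ , sat₂) → (W , valid , c , sat₁) , (W , valid , c , sat₂)))
    (Regular-× R₁ R₂)

  Regular-Satisfying-disj : ∀ {n φ χ} → RegularSat n φ → RegularSat n χ → RegularSat n (disj φ χ)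
  Regular-Satisfying-disj R₁ R₂ = Regular-resp
    (λ y → mk⇔ (λ { (inj₁ (W , valid , c , sat)) → W , valid , c , inj₁ sat
                  ; (inj₂ (W , valid , c , sat)) → W , valid , c , inj₂ sat })
               (λ { (W , valid , c , inj₁ sat) → inj₁ (W , valid , c , sat)
                  ; (W , valid , c , inj₂ sat) → inj₂ (W , valid , c , sat) }))
    (Regular-⊎ R₁ R₂)

  Regular-Satisfying-ex : ∀ {n φ} → RegularSat (suc n) φ → RegularSat n (ex φ)
  Regular-Satisfying-ex {n} {φ} R = Regular-resp (λ y → mk⇔ (sound y) (complete y))
    (Regular-∃ (finite-Maybe (finite-Fin s)) (Regular-comap extend R))
    where
    sound : ∀ y → (∃ λ g → length g ≡ length y × Satisfying (suc n) φ (map extend (zip y g))) → Satisfying n (ex φ) y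
    sound y (g , |g| , (D₀ , Ds , (u , vs)) , (odd , str , (acc , accs)) , columns≡ , sat) =
      (D₀ , Ds , vs) , (odd , str , accs) , columns≡y , u , acc , sat
      where
      columns≡y = proj₁ (map-extend-zip-injective
        (trans (length-columns (D₀ , Ds , vs)) (sym (length-padTo (length D₀) u))) (sym |g|)
        (trans (sym (columns-∷ D₀ Ds u vs)) columns≡))
    complete : ∀ y → Satisfying n (ex φ) y → ∃ λ g → length g ≡ length y × Satisfying (suc n) φ (map extend (zip y g))
    complete y ((D₀ , Ds , vs) , (odd , str , accs) , columns≡ , u , acc , sat) =
      padTo (length D₀) u ,
      trans (length-padTo (length D₀) u) (trans (sym (length-columns (D₀ , Ds , vs))) (cong length columns≡)) ,
      (D₀ , Ds , (u , vs)) , (odd , str , (acc , accs)) ,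
      trans (columns-∷ D₀ Ds u vs) (cong (λ y → map extend (zip y (padTo (length D₀) u))) columns≡) , sat

  -- Constructively ∀ is only ¬∃¬ for decidable bodies; decidability comes from regularity.
  all⇔¬ex¬ : ∀ {n φ} → RegularSat (suc n) φ → ∀ (W : Tuple n) → Valid W →
             Satisfies W (all φ) ⇔ Satisfies W (neg (ex (neg φ)))
  all⇔¬ex¬ {φ = φ} R (D₀ , Ds , vs) (odd , str , accs) = mk⇔
    (λ sat (u , acc , ¬sat) → ¬sat (sat u acc))
    (λ ¬counterexample u acc → decidable-stable (Satisfies-dec {φ = φ} R (D₀ , Ds , (u , vs)) (odd , str , (acc , accs)))
                                               (λ ¬sat → ¬counterexample (u , acc , ¬sat)))

  map-layers : ∀ {n} (W : Tuple n) (f : SymTup LTs → B) →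
               map (f ∘ proj₁ ∘ proj₂) (columns W) ≡ map f (tensorN LTs (length (proj₁ W)) (proj₁ (proj₂ W)))
  map-layers (D₀ , Ds , vs) f = trans (map-∘ {g = f} (columns (D₀ , Ds , vs)))
    (cong (map f) (trans (map-∘ (columns (D₀ , Ds , vs))) (sym (proj₁ (proj₂ (to (columns≡⇔ D₀ Ds vs _) refl))))))

  map-vertices : ∀ {n} (W : Tuple n) (f : SymTup (Vs n) → B) →
                 map (f ∘ proj₂ ∘ proj₂) (columns W) ≡ map f (tensorN (Vs n) (length (proj₁ W)) (proj₂ (proj₂ W)))
  map-vertices (D₀ , Ds , vs) f = trans (map-∘ {g = f} (columns (D₀ , Ds , vs)))
    (cong (map f) (trans (map-∘ (columns (D₀ , Ds , vs))) (sym (proj₂ (proj₂ (to (columns≡⇔ D₀ Ds vs _) refl))))))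

  atomLetter : ∀ {n} (i : Fin (length τ)) → Vec (Fin n) (Data.List.lookup τ i) → Column n →
               LayerT s w (Data.List.lookup τ i) × Maybe (Tens (Fin s) (Data.List.lookup τ i))
  atomLetter i xs c = fromMaybe default-layer (getSym τ (proj₁ (proj₂ c)) i) , collapse _ (select xs (proj₂ (proj₂ c)))

  AtomPath : ∀ {n} (i : Fin (length τ)) → Vec (Fin n) (Data.List.lookup τ i) → List (Column n) → Set
  AtomPath i xs y = AcceptingPath (map proj₁ (map (atomLetter i xs) y)) (map proj₂ (map (atomLetter i xs) y))

  selected : ∀ {n a} → StrTup (Vs n) → Vec (Fin n) a → StrTup (replicate a (Fin s))
  selected {n} vs xs = vecToTup (Data.Vec.map (lookup (tupToVec n vs)) xs)

  maxLen-selected : ∀ {n a} (W : Tuple n) → Valid W → (xs : Vec (Fin n) a) →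
                    maxLen (replicate a (Fin s)) (selected (proj₂ (proj₂ W)) xs) ≤ length (proj₁ W)
  maxLen-selected {n} (D₀ , Ds , vs) (_ , _ , accs) =
    maxLen-select≤ (length D₀) (tupToVec n vs) (λ j → proj₁ (proj₂ (lookup-allRep n vs accs j)))

  atomLayers-columns : ∀ {n} i xs (W : Tuple n) → Valid W →
                       map proj₁ (map (atomLetter i xs) (columns W)) ≡ getD s w τ (proj₁ (proj₂ W)) i
  atomLayers-columns i xs W@(D₀ , Ds , vs) (_ , str , _) = begin
    map proj₁ (map (atomLetter i xs) (columns W))                          ≡⟨ sym (map-∘ (columns W)) ⟩
    map ((fromMaybe default-layer ∘ λ c → getSym τ c i) ∘ proj₁ ∘ proj₂) (columns W) ≡⟨ map-layers W _ ⟩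
    map (fromMaybe default-layer ∘ λ c → getSym τ c i) (tensorN LTs k Ds) ≡⟨ map-∘ (tensorN LTs k Ds) ⟩
    map (fromMaybe default-layer) (map (λ c → getSym τ c i) (tensorN LTs k Ds))
      ≡⟨ cong (map (fromMaybe default-layer)) (map-getSym-tensorN τ k Ds i) ⟩
    map (fromMaybe default-layer) (padTo k D)
      ≡⟨ cong (λ j → map (fromMaybe default-layer) (padTo j D)) (sym (proj₁ (allStructural-IsODD τ k D₀ Ds str i))) ⟩
    map (fromMaybe default-layer) (padTo (length D) D)                     ≡⟨ cong (map (fromMaybe default-layer)) (padTo-length D) ⟩
    map (fromMaybe default-layer) (map just D)                             ≡⟨ trans (sym (map-∘ D)) (map-id D) ⟩
    D                                                                      ∎
    where
    open ≡-Reasoning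
    k = length D₀
    D = getD s w τ Ds i

  atomLetters-columns : ∀ {n} i xs (W : Tuple n) → Valid W →
    map proj₂ (map (atomLetter i xs) (columns W)) ≡ pad (length (proj₁ W)) (tensor _ (selected (proj₂ (proj₂ W)) xs))
  atomLetters-columns {n} i xs W@(D₀ , Ds , vs) valid = begin
    map proj₂ (map (atomLetter i xs) (columns W))                    ≡⟨ sym (map-∘ (columns W)) ⟩
    map ((collapse As ∘ select xs) ∘ proj₂ ∘ proj₂) (columns W)      ≡⟨ map-vertices W _ ⟩
    map (collapse As ∘ select xs) (tensorN (Vs n) k vs)              ≡⟨ map-∘ (tensorN (Vs n) k vs) ⟩
    map (collapse As) (map (select xs) (tensorN (Vs n) k vs))        ≡⟨ cong (map (collapse As)) (sym (tensorN-select k vs xs)) ⟩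
    map (collapse As) (tensorN As k (selected vs xs))                ≡⟨ sym (pad-tensor As k _ (maxLen-selected W valid xs)) ⟩
    pad k (tensor As (selected vs xs))                               ∎
    where
    open ≡-Reasoning
    k = length D₀
    As = replicate (Data.List.lookup τ i) (Fin s)

  atom⇔path : ∀ {n} i xs (W : Tuple n) → Valid W →
              Satisfies W (atom i xs) ⇔ (0 < Data.List.lookup τ i × AtomPath i xs (columns W))
  atom⇔path {n} i xs W@(D₀ , Ds , vs) valid@(_ , str , accs) =
    (positive⇔ ×-⇔ ≡⇒⇔ (cong₂ AcceptingPath (sym (atomLayers-columns i xs W valid))
                                            (trans (cong (λ j → pad j t) |D|) (sym (atomLetters-columns i xs W valid)))))
    ⇔-∘ accepts⇔padded-path (getD s w τ Ds i) t
          (subst (length t ≤_) (sym |D|) (subst (_≤ length D₀) (sym |t|) (maxLen-selected W valid xs)))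
    where
    t = tensor _ (selected vs xs)
    |D| = proj₁ (allStructural-IsODD τ (length D₀) D₀ Ds str i)
    |t| = length-tensorN _ _ (selected vs xs)
    positive⇔ : 0 < length t ⇔ 0 < Data.List.lookup τ i
    positive⇔ = subst (λ m → (0 < m) ⇔ _) (sym |t|)
                      (maxLen-select-positive (tupToVec n vs) (λ j → proj₁ (lookup-allRep n vs accs j)) xs)

  Regular-Satisfying-atom : ∀ {n} i xs → RegularSat n (atom i xs)
  Regular-Satisfying-atom {n} i xs = Regular-resp
    (λ y → mk⇔
      (λ ((W , valid , c) , pos , path) → W , valid , c , from (atom⇔path i xs W valid) (pos , subst (AtomPath i xs) (sym c) path))
      (λ (W , valid , c , sat) → let (pos , path) = to (atom⇔path i xs W valid) sat
                                 in (W , valid , c) , pos , subst (AtomPath i xs) c path))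
    (Regular-× (Regular-Encodes n)
      (Regular-× (Regular-const (0 <? Data.List.lookup τ i)) (Regular-comap (atomLetter i xs) (Regular-AcceptingPath _ w))))

  equal⇔all : ∀ {n} (i j : Fin n) (W : Tuple n) → Valid W →
    Satisfies W (equal i j) ⇔ All (λ c → lookupSym (proj₂ (proj₂ c)) i ≡ lookupSym (proj₂ (proj₂ c)) j) (columns W)
  equal⇔all {n} i j W@(D₀ , Ds , vs) (_ , _ , accs) =
    ⇔-sym (All-≡⇔map-≡ (columns W))
    ⇔-∘ (≡⇒⇔ (sym (cong₂ _≡_ (trans (map-vertices W _) (map-lookupSym-tensorN n k vs i))
                             (trans (map-vertices W _) (map-lookupSym-tensorN n k vs j))))
    ⇔-∘ mk⇔ (cong (padTo k)) (padTo-injective k (bound i) (bound j)))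
    where
    k = length D₀
    bound : ∀ i → length (lookup (tupToVec n vs) i) ≤ k
    bound i = proj₁ (proj₂ (lookup-allRep n vs accs i))

  Regular-Satisfying-equal : ∀ {n} (i j : Fin n) → RegularSat n (equal i j)
  Regular-Satisfying-equal {n} i j = Regular-resp
    (λ y → mk⇔ (λ ((W , valid , c) , same) → W , valid , c , from (equal⇔all i j W valid) (subst (All _) (sym c) same))
               (λ (W , valid , c , sat) → (W , valid , c) , subst (All _) c (to (equal⇔all i j W valid) sat)))
    (Regular-× (Regular-Encodes n) (Regular-All λ c → ≡-dec _≟ᶠ_ (lookupSym (proj₂ (proj₂ c)) i) (lookupSym (proj₂ (proj₂ c)) j)))

  Regular-Satisfying : ∀ n (φ : Formula τ n) → RegularSat n φ
  Regular-Satisfying n (atom i xs)  = Regular-Satisfying-atom i xs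
  Regular-Satisfying n (equal i j)  = Regular-Satisfying-equal i j
  Regular-Satisfying n (neg φ)      = Regular-Satisfying-neg {φ = φ} (Regular-Satisfying n φ)
  Regular-Satisfying n (conj φ χ)   = Regular-Satisfying-conj {φ = φ} {χ} (Regular-Satisfying n φ) (Regular-Satisfying n χ)
  Regular-Satisfying n (disj φ χ)   = Regular-Satisfying-disj {φ = φ} {χ} (Regular-Satisfying n φ) (Regular-Satisfying n χ)
  Regular-Satisfying n (ex φ)       = Regular-Satisfying-ex {φ = φ} (Regular-Satisfying (suc n) φ)
  Regular-Satisfying n (all φ)      =
    Regular-resp (Satisfying-cong {φ = neg (ex (neg φ))} {all φ} (λ W valid → ⇔-sym (all⇔¬ex¬ {φ = φ} body W valid)))
    (Regular-Satisfying-neg {φ = ex (neg φ)} (Regular-Satisfying-ex {φ = neg φ} (Regular-Satisfying-neg {φ = φ} body)))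
    where body = Regular-Satisfying (suc n) φ

module TensorColumns (s w : ℕ) (τ : Vocab) (n : ℕ) where
  open TensorPowers (Fin s) w using (allNE-accepted; maxLen-accepted)
  open StructuralTuples s w using (maxLen-structural; allNE-structural)
  open ColumnEncoding s w τ

  Sig : List Set
  Sig = FOSig s w τ n

  toColumn : SymTup Sig → Column n
  toColumn = map₂ (splitSym LTs (Vs n))

  toColumn-injective : ∀ {c c′} → toColumn c ≡ toColumn c′ → c ≡ c′
  toColumn-injective {c₀ , c} {c₀′ , c′} e =
    trans (cong (c₀ ,_) (sym (joinSym-splitSym LTs (Vs n) c)))
          (trans (cong (map₂ (joinSym LTs (Vs n))) e) (cong (c₀′ ,_) (joinSym-splitSym LTs (Vs n) c′)))

  map-toColumn-tensorN : ∀ D₀ Ds vs →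
    map toColumn (tensorN Sig (length D₀) (D₀ , joinTup LTs (Vs n) Ds vs)) ≡ columns (D₀ , Ds , vs)
  map-toColumn-tensorN D₀ Ds vs = begin
    map toColumn (tensorN Sig k (D₀ , joinTup LTs (Vs n) Ds vs))
      ≡⟨ cong (map toColumn) (tensorN-∷ _ (LTs ++ Vs n) k D₀ _) ⟩
    map toColumn (zip (padTo k D₀) (tensorN (LTs ++ Vs n) k (joinTup LTs (Vs n) Ds vs)))
      ≡⟨ map-map₂-zip (splitSym LTs (Vs n)) (padTo k D₀) _ ⟩
    zip (padTo k D₀) (map (splitSym LTs (Vs n)) (tensorN (LTs ++ Vs n) k (joinTup LTs (Vs n) Ds vs)))
      ≡⟨ cong₂ zip (padTo-length D₀) (map-splitSym-tensorN LTs (Vs n) k Ds vs) ⟩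
    columns (D₀ , Ds , vs) ∎
    where
    open ≡-Reasoning
    k = length D₀

  maxLen-valid : ∀ D₀ Ds vs → Valid (D₀ , Ds , vs) → maxLen Sig (D₀ , joinTup LTs (Vs n) Ds vs) ≡ length D₀
  maxLen-valid D₀ Ds vs (_ , str , accs) =
    trans (cong (length D₀ ⊔_) (maxLen-joinTup LTs (Vs n) Ds vs))
          (m≥n⇒m⊔n≡m (⊔-lub (maxLen-structural τ _ D₀ Ds str) (maxLen-accepted n D₀ vs accs)))

  Satisfying⇔FORel : ∀ φ x → Satisfying n φ (map toColumn x) ⇔ (∃ λ us → AllNE Sig us × FORel s w τ n φ us × tensor Sig us ≡ x)
  Satisfying⇔FORel φ x = mk⇔ sound complete
    where
    sound : Satisfying n φ (map toColumn x) → ∃ λ us → AllNE Sig us × FORel s w τ n φ us × tensor Sig us ≡ x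
    sound ((D₀ , Ds , vs) , valid@(odd , str , accs) , columns≡ , sat) =
      (D₀ , joinTup LTs (Vs n) Ds vs) ,
      (proj₁ (proj₂ odd) , allNE-joinTup LTs (Vs n) Ds vs (allNE-structural τ _ D₀ Ds str) (allNE-accepted n vs accs)) ,
      subst (λ (Ds , vs) → IsStructural s w τ D₀ Ds × AllRep n (AcceptsODD D₀) vs × Sat (derived s w τ D₀ Ds) φ (tupToVec n vs))
            (sym (splitTup-joinTup LTs (Vs n) Ds vs)) ((length D₀ , odd , str) , accs , sat) ,
      map-injective {f = toColumn} toColumn-injective
        (trans (cong (λ k → map toColumn (tensorN Sig k (D₀ , joinTup LTs (Vs n) Ds vs))) (maxLen-valid D₀ Ds vs valid))
               (trans (map-toColumn-tensorN D₀ Ds vs) columns≡))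
    complete : (∃ λ us → AllNE Sig us × FORel s w τ n φ us × tensor Sig us ≡ x) → Satisfying n φ (map toColumn x)
    complete ((D₀ , rest) , _ , ((k , odd , str) , accs , sat) , tensor≡) with proj₁ odd
    ... | refl = (D₀ , Ds , vs) , valid , columns≡ , sat
      where
      Ds = proj₁ (splitTup LTs (Vs n) rest)
      vs = proj₂ (splitTup LTs (Vs n) rest)
      valid : Valid (D₀ , Ds , vs)
      valid = odd , str , accs
      rest≡ : joinTup LTs (Vs n) Ds vs ≡ rest
      rest≡ = joinTup-splitTup LTs (Vs n) rest
      columns≡ : columns (D₀ , Ds , vs) ≡ map toColumn x
      columns≡ = trans (sym (map-toColumn-tensorN D₀ Ds vs))
        (cong (map toColumn) (trans (cong (λ r → tensorN Sig (length D₀) (D₀ , r)) rest≡)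
          (trans (cong (λ k → tensorN Sig k (D₀ , rest))
                       (sym (trans (cong (λ r → maxLen Sig (D₀ , r)) (sym rest≡)) (maxLen-valid D₀ Ds vs valid))))
                 tensor≡)))

theorem4 : (s w : ℕ) → 1 ≤ w → (τ : Vocab) → (n : ℕ) → (φ : Formula τ n) →
    RegularRel (FOSig s w τ n) (FORel s w τ n φ)
theorem4 s w _ τ n φ = toDFA M , λ x → Satisfying⇔FORel φ x ⇔-∘ (recognizes x ⇔-∘ AcceptsDFA-toDFA M x)
  where
  open TensorColumns s w τ n
  open ColumnEncoding s w τ using (Regular-Satisfying)
  regular = Regular-comap toColumn (Regular-Satisfying n φ)
  M = proj₁ regular
  recognizes = proj₂ regular
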